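{- If $n\ge 3$ is an integer, then $$\xi(C_n\square K_2)=\begin{cases}\frac{5n-2}{4}, & \text{if } n\equiv 2\pmod 4,\\ n, & \text{otherwise.}\end{cases}$$
   Context: All graphs are finite, simple, connected and undirected; $d_G(u,v)$ is the shortest-path distance. A set $D\subseteq V(G)$ is a distance-equalizer set of $G$ if for any two vertices $x,y\in V(G)\setminus D$ there is $w\in D$ with $d_G(x,w)=d_G(y,w)$. The equidistant dimension $\xi(G)$ is the minimum cardinality of a distance-equalizer set of $G$. $C_n$ is the cycle on $n$ vertices and $K_2$ the complete graph on two vertices. The Cartesian product $G\square H$ has vertex set $V(G)\times V(H)$, with $(g,h)\sim(g',h')$ iff either $g=g'$ and $hh'\in E(H)$, or $h=h'$ and $gg'\in E(G)$. -}

module Defs where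

open import Level using (0ℓ)
open import Data.Nat using (ℕ; zero; suc; _≤_)
open import Data.Fin using (Fin; toℕ)
open import Data.Product using (_×_; ∃; Σ)
open import Data.Sum using (_⊎_)
open import Data.List using (List; length)
open import Data.List.Membership.Propositional using (_∈_; _∉_)
open import Data.List.Relation.Unary.Unique.Propositional using (Unique)
open import Relation.Binary.PropositionalEquality using (_≡_; _≢_)

record Graph : Set₁ where
  field
    V   : Set
    Adj : V → V → Set
open Graph public

data Walk (G : Graph) : V G → V G → ℕ → Set where
  nil  : ∀ {x} → Walk G x x 0
  cons : ∀ {x y z k} → Adj G x y → Walk G y z k → Walk G x z (suc k)

Dist : (G : Graph) → V G → V G → ℕ → Set
Dist G x y k = Walk G x y k × (∀ m → Walk G x y m → k ≤ m)

Cycle : ℕ → Graph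
Cycle n = record
  { V = Fin n
  ; Adj = λ i j → (toℕ j ≡ suc (toℕ i)) ⊎ (toℕ i ≡ suc (toℕ j))
                 ⊎ ((toℕ i ≡ 0) × (suc (toℕ j) ≡ n))
                 ⊎ ((toℕ j ≡ 0) × (suc (toℕ i) ≡ n))
  }

K2 : Graph
K2 = record { V = Fin 2 ; Adj = λ i j → i ≢ j }

_□_ : Graph → Graph → Graph
G □ H = record
  { V = V G × V H
  ; Adj = λ p q → ((Data.Product.proj₁ p ≡ Data.Product.proj₁ q) × Adj H (Data.Product.proj₂ p) (Data.Product.proj₂ q))
                ⊎ ((Data.Product.proj₂ p ≡ Data.Product.proj₂ q) × Adj G (Data.Product.proj₁ p) (Data.Product.proj₁ q))
  }

IsDistanceEqualizer : (G : Graph) → List (V G) → Set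
IsDistanceEqualizer G D =
  ∀ x y → x ≢ y → x ∉ D → y ∉ D →
  ∃ λ w → w ∈ D × ∃ λ k → Dist G x w k × Dist G y w k

EquidistantDimension : Graph → ℕ → Set
EquidistantDimension G k =
  (Σ (List (V G)) λ D → Unique D × IsDistanceEqualizer G D × length D ≡ k)
  × (∀ (D : List (V G)) → Unique D → IsDistanceEqualizer G D → k ≤ length D)

module Submission where

-- Write d((i , b) , (k , e)) = d_C(i , k) + [b ≠ e]. The two ends of a rung are at distances differing
-- by exactly one from every vertex, so a distance-equalizer set meets every rung and ξ ≥ n. For odd n
-- a whole layer suffices: any two rungs bound an arc of even length, whose midpoint equalizes them.
-- For even n the prism is bipartite, and two vertices of different colours are never equalized, so all
-- vertices outside D have one colour. One colour class, the black one, equalizes every pair of white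
-- vertices except those on different layers whose rungs cut C_n into arcs 2t + 1 and 2t' + 1 with t
-- and t' odd. When 4 ∣ n this cannot happen; when n = 4m + 2 the m white vertices (2a , ℓ₀), a < m,
-- equalize the remaining pairs. Conversely, for n = 4m + 2 such a pair of outsiders can only be
-- equalized from four particular rungs, so one of these must lie entirely in D; a double
-- counting over the rungs shows that at least m rungs do, whence |D| ≥ n + m.

open import Defs
open import Algebra.Bundles using (CommutativeRing)
open import Data.Bool using (Bool; true; false; not; _xor_)
open import Data.Bool.Properties using (not-involutive; not-¬; xor-assoc; xor-comm; xor-same; xor-identityʳ; xor-∧-commutativeRing)
open import Data.Empty using (⊥; ⊥-elim)
open import Data.Fin as F using (Fin; toℕ; fromℕ<)
open import Data.Fin.Properties using (toℕ-injective; toℕ<n; toℕ-fromℕ<; toℕ-fromℕ; any?)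
open import Data.List using (List; []; _∷_; length; _++_; tabulate)
open import Data.List.Membership.Propositional using (_∈_; _∉_)
open import Data.List.Membership.Propositional.Properties using (∈-tabulate⁻; ∈-tabulate⁺; ∈-++⁺ˡ; ∈-++⁺ʳ; ∈-++⁻)
open import Data.List.Properties using (length-tabulate; length-++)
import Data.List.Relation.Unary.All as All
import Data.List.Relation.Unary.AllPairs as AllPairs
open import Data.List.Relation.Unary.Any using (here; there)
open import Data.List.Relation.Unary.Unique.Propositional using (Unique)
open import Data.List.Relation.Unary.Unique.Propositional.Properties using (tabulate⁺; ++⁺)
open import Data.Nat
open import Data.Nat.DivMod using (m%n<n; m<n⇒m%n≡m; [m+n]%n≡m%n; m≡m%n+[m/n]*n; m*n/n≡m)
open import Data.Nat.Properties
open import Data.Nat.Tactic.RingSolver using (solve-∀)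
open import Data.Product using (_×_; _,_; proj₁; proj₂; Σ)
open import Data.Product.Properties using (≡-dec)
open import Data.Sum using (_⊎_; inj₁; inj₂)
open import Function using (_∘_)
open import Relation.Binary.Definitions using (DecidableEquality; tri<; tri≈; tri>)
open import Relation.Binary.PropositionalEquality
open import Relation.Nullary using (¬_; Dec; yes; no; _×-dec_)

open import Algebra.Properties.CommutativeSemigroup (CommutativeRing.+-commutativeSemigroup xor-∧-commutativeRing) using (interchange)
open import Algebra.Properties.Group (CommutativeRing.+-group xor-∧-commutativeRing) using (x∙y⁻¹≈ε⇒x≈y; ∙-cancelˡ; ∙-cancelʳ)

-- Distances on C_n

arcDist : ℕ → ℕ → ℕ
arcDist n δ = δ ⊓ (n ∸ δ)

cycleDist : ℕ → ℕ → ℕ → ℕ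
cycleDist n i k = arcDist n ∣ i - k ∣

cycleDist-self : ∀ n i → cycleDist n i i ≡ 0
cycleDist-self n i rewrite ∣n-n∣≡0 i = refl

m≥n⇒∣m-n∣≡m∸n : ∀ {m n} → n ≤ m → ∣ m - n ∣ ≡ m ∸ n
m≥n⇒∣m-n∣≡m∸n {m} {n} p = trans (∣-∣-comm m n) (m≤n⇒∣m-n∣≡n∸m p)

≤⇒∃+ : ∀ {a b} → a ≤ b → Σ ℕ λ d → b ≡ a + d
≤⇒∃+ {a} {b} p = b ∸ a , sym (m+[n∸m]≡n p)

⊓-≤-suc : ∀ {a b c d} → a ≤ suc c → b ≤ suc d → a ⊓ b ≤ suc (c ⊓ d)
⊓-≤-suc {a} {b} {c} {d} p q with ⊓-sel c d
... | inj₁ e rewrite e = ≤-trans (m⊓n≤m a b) p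
... | inj₂ e rewrite e = ≤-trans (m⊓n≤n a b) q

⊓-≤-suc′ : ∀ {a b c d} → a ≤ suc d → b ≤ suc c → a ⊓ b ≤ suc (c ⊓ d)
⊓-≤-suc′ {a} {b} {c} {d} p q = subst (λ z → a ⊓ b ≤ suc z) (⊓-comm d c) (⊓-≤-suc p q)

m∸n≤1+m∸[1+n] : ∀ m d → m ∸ d ≤ suc (m ∸ suc d)
m∸n≤1+m∸[1+n] zero d rewrite 0∸n≡0 d = z≤n
m∸n≤1+m∸[1+n] (suc m) zero = ≤-refl
m∸n≤1+m∸[1+n] (suc m) (suc d) = m∸n≤1+m∸[1+n] m d

∸-lipschitzʳ : ∀ m {d e} → e ≤ suc d → m ∸ d ≤ suc (m ∸ e)
∸-lipschitzʳ m {d} {zero} p = ≤-trans (m∸n≤m m d) (n≤1+n m)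
∸-lipschitzʳ m {d} {suc e} (s≤s p) = ≤-trans (∸-monoʳ-≤ m p) (m∸n≤1+m∸[1+n] m e)

arcDist-lipschitz : ∀ n {d e} → d ≤ suc e → e ≤ suc d → arcDist n d ≤ suc (arcDist n e)
arcDist-lipschitz n p q = ⊓-≤-suc p (∸-lipschitzʳ n q)

∣m-n∣≤1+∣1+m-n∣ : ∀ m n → ∣ m - n ∣ ≤ suc ∣ suc m - n ∣
∣m-n∣≤1+∣1+m-n∣ zero zero = z≤n
∣m-n∣≤1+∣1+m-n∣ zero (suc n) = ≤-refl
∣m-n∣≤1+∣1+m-n∣ (suc m) zero = ≤-trans (n≤1+n _) (n≤1+n _)
∣m-n∣≤1+∣1+m-n∣ (suc m) (suc n) = ∣m-n∣≤1+∣1+m-n∣ m n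

∣1+m-n∣≤1+∣m-n∣ : ∀ m n → ∣ suc m - n ∣ ≤ suc ∣ m - n ∣
∣1+m-n∣≤1+∣m-n∣ zero zero = ≤-refl
∣1+m-n∣≤1+∣m-n∣ zero (suc n) = ≤-trans (n≤1+n _) (n≤1+n _)
∣1+m-n∣≤1+∣m-n∣ (suc m) zero = ≤-refl
∣1+m-n∣≤1+∣m-n∣ (suc m) (suc n) = ∣1+m-n∣≤1+∣m-n∣ m n

cycleDist-suc : ∀ n i k → cycleDist n i k ≤ suc (cycleDist n (suc i) k)
cycleDist-suc n i k = arcDist-lipschitz n (∣m-n∣≤1+∣1+m-n∣ i k) (∣1+m-n∣≤1+∣m-n∣ i k)

cycleDist-pred : ∀ n i k → cycleDist n (suc i) k ≤ suc (cycleDist n i k)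
cycleDist-pred n i k = arcDist-lipschitz n (∣1+m-n∣≤1+∣m-n∣ i k) (∣m-n∣≤1+∣1+m-n∣ i k)

[1+j]∸[j∸k]≡1+k : ∀ j k → k ≤ j → suc j ∸ (j ∸ k) ≡ suc k
[1+j]∸[j∸k]≡1+k j k k≤j = trans (+-∸-assoc 1 (m∸n≤m j k)) (cong suc (m∸[m∸n]≡n k≤j))

arcDist-wrapˡ : ∀ j k → k ≤ j → arcDist (suc j) k ≤ suc (arcDist (suc j) (j ∸ k))
arcDist-wrapˡ j k k≤j = ⊓-≤-suc′ p q
  where
  p : k ≤ suc (suc j ∸ (j ∸ k))
  p rewrite [1+j]∸[j∸k]≡1+k j k k≤j = ≤-trans (n≤1+n k) (n≤1+n (suc k))
  q : suc j ∸ k ≤ suc (j ∸ k)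
  q rewrite +-∸-assoc 1 k≤j = ≤-refl

arcDist-wrapʳ : ∀ j k → k ≤ j → arcDist (suc j) (j ∸ k) ≤ suc (arcDist (suc j) k)
arcDist-wrapʳ j k k≤j = ⊓-≤-suc′ p q
  where
  p : j ∸ k ≤ suc (suc j ∸ k)
  p rewrite +-∸-assoc 1 k≤j = ≤-trans (n≤1+n _) (n≤1+n _)
  q : suc j ∸ (j ∸ k) ≤ suc k
  q rewrite [1+j]∸[j∸k]≡1+k j k k≤j = ≤-refl

arcDist-short : ∀ {n a b} → a + b ≡ n → a ≤ b → arcDist n a ≡ a
arcDist-short {n} {a} {b} e p rewrite sym e | m+n∸m≡n a b = m≤n⇒m⊓n≡m p

arcDist-long : ∀ {n a b} → a + b ≡ n → b ≤ a → arcDist n a ≡ b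
arcDist-long {n} {a} {b} e p rewrite sym e | m+n∸m≡n a b = m≥n⇒m⊓n≡n p

arcDist-complement : ∀ {n a b} → a + b ≡ n → arcDist n a ≡ arcDist n b
arcDist-complement {n} {a} {b} e rewrite sym e | m+n∸m≡n a b | m+n∸n≡m a b = ⊓-comm a b

-- Positions on C_n are natural numbers; Reduces n t k says that k is t reduced modulo n
-- with at most one wrap-around (so t < 2n whenever k < n).
Reduces : ℕ → ℕ → ℕ → Set
Reduces n t k = (k ≡ t) ⊎ (k + n ≡ t)

cycleDist-ahead : ∀ {n i k a} → a ≤ n → Reduces n (i + a) k → cycleDist n i k ≡ arcDist n a
cycleDist-ahead {n} {i} {k} {a} p (inj₁ e) = cong (arcDist n) (trans (cong (∣ i -_∣) e) (∣m-m+n∣≡n i a))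
cycleDist-ahead {n} {i} {k} {a} p (inj₂ e) = begin
  arcDist n ∣ i - k ∣           ≡⟨ cong (arcDist n) (trans (∣-∣-comm i k) (cong (∣ k -_∣) i≡k+[n∸a])) ⟩
  arcDist n ∣ k - k + (n ∸ a) ∣ ≡⟨ cong (arcDist n) (∣m-m+n∣≡n k (n ∸ a)) ⟩
  arcDist n (n ∸ a)             ≡⟨ arcDist-complement (m∸n+n≡m p) ⟩
  arcDist n a                   ∎
  where
  open ≡-Reasoning
  i≡k+[n∸a] : i ≡ k + (n ∸ a)
  i≡k+[n∸a] = +-cancelʳ-≡ a i (k + (n ∸ a))
    (sym (trans (+-assoc k (n ∸ a) a) (trans (cong (k +_) (m∸n+n≡m p)) e)))

cycleDist-behind : ∀ {n i k a} → a ≤ n → Reduces n (k + a) i → cycleDist n i k ≡ arcDist n a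
cycleDist-behind {n} {i} {k} {a} p h = trans (cong (arcDist n) (∣-∣-comm i k)) (cycleDist-ahead p h)

reduce : ∀ {n} i a → i < n → a ≤ n → Σ ℕ λ k → k < n × Reduces n (i + a) k
reduce {n} i a p q with i + a <? n
... | yes r = i + a , r , inj₁ refl
... | no r = i + a ∸ n , lt , inj₂ (m∸n+n≡m (≮⇒≥ r))
  where
  lt : i + a ∸ n < n
  lt = +-cancelʳ-< n _ n (subst (_< n + n) (sym (m∸n+n≡m (≮⇒≥ r))) (+-mono-<-≤ p q))

-- Parity

isOdd : ℕ → Bool
isOdd zero = false
isOdd (suc m) = not (isOdd m)

not-xor : ∀ a b → not (a xor b) ≡ not a xor b
not-xor false b = refl
not-xor true b = not-involutive b

isOdd-+ : ∀ a b → isOdd (a + b) ≡ isOdd a xor isOdd b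
isOdd-+ zero b = refl
isOdd-+ (suc a) b = trans (cong not (isOdd-+ a b)) (not-xor (isOdd a) (isOdd b))

isOdd-double : ∀ h → isOdd (h + h) ≡ false
isOdd-double h = trans (isOdd-+ h h) (xor-same (isOdd h))

isOdd-∸ : ∀ a b → b ≤ a → isOdd (a ∸ b) ≡ isOdd a xor isOdd b
isOdd-∸ a b p = sym (begin
  isOdd a xor isOdd b                       ≡⟨ cong (λ z → isOdd z xor isOdd b) (sym (m∸n+n≡m p)) ⟩
  isOdd ((a ∸ b) + b) xor isOdd b           ≡⟨ cong (_xor isOdd b) (isOdd-+ (a ∸ b) b) ⟩
  (isOdd (a ∸ b) xor isOdd b) xor isOdd b   ≡⟨ xor-assoc (isOdd (a ∸ b)) (isOdd b) (isOdd b) ⟩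
  isOdd (a ∸ b) xor (isOdd b xor isOdd b)   ≡⟨ cong (isOdd (a ∸ b) xor_) (xor-same (isOdd b)) ⟩
  isOdd (a ∸ b) xor false                   ≡⟨ xor-identityʳ (isOdd (a ∸ b)) ⟩
  isOdd (a ∸ b)                             ∎)
  where open ≡-Reasoning

isOdd-∣-∣ : ∀ a b → isOdd ∣ a - b ∣ ≡ isOdd a xor isOdd b
isOdd-∣-∣ a b with ≤-total a b
... | inj₁ p rewrite m≤n⇒∣m-n∣≡n∸m p = trans (isOdd-∸ b a p) (xor-comm (isOdd b) (isOdd a))
... | inj₂ p rewrite m≥n⇒∣m-n∣≡m∸n p = isOdd-∸ a b p

halve : ∀ m → Σ ℕ λ h → (m ≡ h + h) ⊎ (m ≡ suc (h + h))
halve zero = 0 , inj₁ refl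
halve (suc m) with halve m
... | h , inj₁ e = h , inj₂ (cong suc e)
... | h , inj₂ e = suc h , inj₁ (trans (cong suc e) (cong suc (sym (+-suc h h))))

even⇒double : ∀ m → isOdd m ≡ false → Σ ℕ λ h → m ≡ h + h
even⇒double m p with halve m
... | h , inj₁ e = h , e
... | h , inj₂ refl with () ← trans (sym (cong not (isOdd-double h))) p

odd⇒suc-double : ∀ m → isOdd m ≡ true → Σ ℕ λ h → m ≡ suc (h + h)
odd⇒suc-double m p with halve m
... | h , inj₂ e = h , e
... | h , inj₁ refl with () ← trans (sym (isOdd-double h)) p

double-injective : ∀ {a b} → a + a ≡ b + b → a ≡ b
double-injective {a} {b} e with <-cmp a b
... | tri< p _ _ = ⊥-elim (<-irrefl e (+-mono-< p p))
... | tri≈ _ p _ = p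
... | tri> _ _ p = ⊥-elim (<-irrefl (sym e) (+-mono-< p p))

isOdd-arcDist : ∀ n δ → isOdd n ≡ false → δ ≤ n → isOdd (arcDist n δ) ≡ isOdd δ
isOdd-arcDist n δ even-n p with ⊓-sel δ (n ∸ δ)
... | inj₁ e rewrite e = refl
... | inj₂ e rewrite e | isOdd-∸ n δ p | even-n = refl

isOdd-cycleDist : ∀ n i k → isOdd n ≡ false → i ≤ n → k ≤ n → isOdd (cycleDist n i k) ≡ isOdd i xor isOdd k
isOdd-cycleDist n i k even-n p q =
  trans (isOdd-arcDist n _ even-n (≤-trans (∣m-n∣≤m⊔n i k) (⊔-lub p q))) (isOdd-∣-∣ i k)

[1+2t]+[1+2t′]≡2[1+t+t′] : ∀ t t' → suc (t + t) + suc (t' + t') ≡ suc (t + t') + suc (t + t')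
[1+2t]+[1+2t′]≡2[1+t+t′] = solve-∀

[1+2t]+[1+2t′]≡2+2[t+t′] : ∀ t t' → suc (t + t) + suc (t' + t') ≡ suc (suc ((t + t') + (t + t')))
[1+2t]+[1+2t′]≡2+2[t+t′] = solve-∀

module _ {A : Set} (_≟_ : DecidableEquality A) where

  remove : A → List A → List A
  remove x [] = []
  remove x (y ∷ ys) with x ≟ y
  ... | yes _ = ys
  ... | no _ = y ∷ remove x ys

  length-remove : ∀ {x ys} → x ∈ ys → suc (length (remove x ys)) ≡ length ys
  length-remove {x} {y ∷ ys} (here x≡y) with x ≟ y
  ... | yes _ = refl
  ... | no x≢y = ⊥-elim (x≢y x≡y)
  length-remove {x} {y ∷ ys} (there p) with x ≟ y
  ... | yes _ = refl
  ... | no _ = cong suc (length-remove p)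

  ∈-remove : ∀ {x y ys} → y ∈ ys → y ≢ x → y ∈ remove x ys
  ∈-remove {x} {y} {z ∷ zs} (here y≡z) y≢x with x ≟ z
  ... | yes x≡z = ⊥-elim (y≢x (trans y≡z (sym x≡z)))
  ... | no _ = here y≡z
  ∈-remove {x} {y} {z ∷ zs} (there p) y≢x with x ≟ z
  ... | yes _ = p
  ... | no _ = there (∈-remove p y≢x)

  Unique⇒length≤ : ∀ {L D : List A} → Unique L → (∀ {z} → z ∈ L → z ∈ D) → length L ≤ length D
  Unique⇒length≤ AllPairs.[] L⊆D = z≤n
  Unique⇒length≤ {x ∷ xs} (x∉xs AllPairs.∷ u) L⊆D =
    ≤-trans (s≤s (Unique⇒length≤ u (λ zi → ∈-remove (L⊆D (there zi)) (λ z≡x → All.lookup x∉xs zi (sym z≡x)))))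
            (≤-reflexive (length-remove (L⊆D (here refl))))

-- The prism C_n □ K₂

module Prism (N : ℕ) where

  n : ℕ
  n = suc N

  C : Graph
  C = Cycle n

  dC : Fin n → Fin n → ℕ
  dC i k = cycleDist n (toℕ i) (toℕ k)

  toℕ≤N : (k : Fin n) → toℕ k ≤ N
  toℕ≤N k = ≤-pred (toℕ<n k)

  dC-adj : ∀ {i j : Fin n} k → Adj C i j → dC i k ≤ suc (dC j k)
  dC-adj {i} {j} k (inj₁ e) rewrite e = cycleDist-suc n (toℕ i) (toℕ k)
  dC-adj {i} {j} k (inj₂ (inj₁ e)) rewrite e = cycleDist-pred n (toℕ j) (toℕ k)
  dC-adj {i} {j} k (inj₂ (inj₂ (inj₁ (i≡0 , 1+j≡n))))
    rewrite i≡0 | suc-injective 1+j≡n | m≥n⇒∣m-n∣≡m∸n (toℕ≤N k) = arcDist-wrapˡ N (toℕ k) (toℕ≤N k)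
  dC-adj {i} {j} k (inj₂ (inj₂ (inj₂ (j≡0 , 1+i≡n))))
    rewrite j≡0 | suc-injective 1+i≡n | m≥n⇒∣m-n∣≡m∸n (toℕ≤N k) = arcDist-wrapʳ N (toℕ k) (toℕ≤N k)

  concatWalk : ∀ {G : Graph} {x y z a b} → Walk G x y a → Walk G y z b → Walk G x z (a + b)
  concatWalk nil w = w
  concatWalk (cons e v) w = cons e (concatWalk v w)

  walkUp : ∀ d (i k : Fin n) → toℕ k ≡ toℕ i + d → Walk C i k d
  walkUp zero i k e = subst (λ z → Walk C i z 0) (toℕ-injective (trans (sym (+-identityʳ _)) (sym e))) nil
  walkUp (suc d) i k e = cons (inj₁ (toℕ-fromℕ< lt)) (walkUp d (fromℕ< lt) k e')
    where
    lt : suc (toℕ i) < n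
    lt = ≤-trans (s≤s (≤-trans (s≤s (m≤m+n (toℕ i) d)) (≤-reflexive (trans (sym (+-suc (toℕ i) d)) (sym e))))) (toℕ<n k)
    e' : toℕ k ≡ toℕ (fromℕ< lt) + d
    e' = trans e (trans (+-suc (toℕ i) d) (cong (_+ d) (sym (toℕ-fromℕ< lt))))

  walkDown : ∀ d (i k : Fin n) → toℕ i ≡ toℕ k + d → Walk C i k d
  walkDown zero i k e = subst (λ z → Walk C i z 0) (toℕ-injective (trans e (+-identityʳ _))) nil
  walkDown (suc d) i k e = cons (inj₂ (inj₁ e1)) (walkDown d (fromℕ< lt) k (toℕ-fromℕ< lt))
    where
    lt : toℕ k + d < n
    lt = ≤-trans (≤-reflexive (sym (trans e (+-suc (toℕ k) d)))) (<⇒≤ (toℕ<n i))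
    e1 : toℕ i ≡ suc (toℕ (fromℕ< lt))
    e1 = trans e (trans (+-suc (toℕ k) d) (cong suc (sym (toℕ-fromℕ< lt))))

  first last : Fin n
  first = F.zero
  last = F.fromℕ N

  first~last : Adj C first last
  first~last = inj₂ (inj₂ (inj₁ (refl , cong suc (toℕ-fromℕ N))))

  last~first : Adj C last first
  last~first = inj₂ (inj₂ (inj₂ (refl , cong suc (toℕ-fromℕ N))))

  walkDirect : (i k : Fin n) → Walk C i k ∣ toℕ i - toℕ k ∣
  walkDirect i k with ≤-total (toℕ i) (toℕ k)
  ... | inj₁ p rewrite m≤n⇒∣m-n∣≡n∸m p = walkUp (toℕ k ∸ toℕ i) i k (sym (m+[n∸m]≡n p))
  ... | inj₂ p rewrite m≥n⇒∣m-n∣≡m∸n p = walkDown (toℕ i ∸ toℕ k) i k (sym (m+[n∸m]≡n p))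

  walkAround : (i k : Fin n) → Walk C i k (n ∸ ∣ toℕ i - toℕ k ∣)
  walkAround i k with ≤-total (toℕ i) (toℕ k)
  ... | inj₁ p rewrite m≤n⇒∣m-n∣≡n∸m p =
    subst (Walk C i k) (viaFirst (toℕ i) (toℕ k) p (toℕ≤N k))
      (concatWalk (walkDown (toℕ i) i first refl)
        (cons first~last (walkDown (N ∸ toℕ k) last k (trans (toℕ-fromℕ N) (sym (m+[n∸m]≡n (toℕ≤N k)))))))
    where
    viaFirst : ∀ a b → a ≤ b → b ≤ N → a + (1 + (N ∸ b)) ≡ suc N ∸ (b ∸ a)
    viaFirst a b p q with ≤⇒∃+ p | ≤⇒∃+ q
    ... | d , refl | r , refl rewrite m+n∸m≡n a d | m+n∸m≡n (a + d) r =
      sym (trans (cong (_∸ d) (ring a d r)) (m+n∸m≡n d (a + (1 + r))))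
      where
      ring : ∀ a d r → suc (a + d + r) ≡ d + (a + (1 + r))
      ring = solve-∀
  ... | inj₂ p rewrite m≥n⇒∣m-n∣≡m∸n p =
    subst (Walk C i k) (viaLast (toℕ i) (toℕ k) p (toℕ≤N i))
      (concatWalk (walkUp (N ∸ toℕ i) i last (trans (toℕ-fromℕ N) (sym (m+[n∸m]≡n (toℕ≤N i)))))
        (cons last~first (walkUp (toℕ k) first k refl)))
    where
    viaLast : ∀ a b → b ≤ a → a ≤ N → (N ∸ a) + (1 + b) ≡ suc N ∸ (a ∸ b)
    viaLast a b p q with ≤⇒∃+ p | ≤⇒∃+ q
    ... | d , refl | r , refl rewrite m+n∸m≡n b d | m+n∸m≡n (b + d) r =
      sym (trans (cong (_∸ d) (ring b d r)) (m+n∸m≡n d (r + (1 + b))))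
      where
      ring : ∀ b d r → suc (b + d + r) ≡ d + (r + (1 + b))
      ring = solve-∀

  cycleWalk : (i k : Fin n) → Walk C i k (dC i k)
  cycleWalk i k with ⊓-sel ∣ toℕ i - toℕ k ∣ (n ∸ ∣ toℕ i - toℕ k ∣)
  ... | inj₁ e = subst (Walk C i k) (sym e) (walkDirect i k)
  ... | inj₂ e = subst (Walk C i k) (sym e) (walkAround i k)

  P : Graph
  P = C □ K2

  Vertex : Set
  Vertex = Fin n × Fin 2

  ℓ₀ ℓ₁ : Fin 2
  ℓ₀ = F.zero
  ℓ₁ = F.suc F.zero

  dK : Fin 2 → Fin 2 → ℕ
  dK F.zero F.zero = 0
  dK F.zero (F.suc F.zero) = 1
  dK (F.suc F.zero) F.zero = 1
  dK (F.suc F.zero) (F.suc F.zero) = 0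

  dK-self : ∀ b → dK b b ≡ 0
  dK-self F.zero = refl
  dK-self (F.suc F.zero) = refl

  dK≤1 : ∀ b e → dK b e ≤ 1
  dK≤1 F.zero F.zero = z≤n
  dK≤1 F.zero (F.suc F.zero) = ≤-refl
  dK≤1 (F.suc F.zero) F.zero = ≤-refl
  dK≤1 (F.suc F.zero) (F.suc F.zero) = z≤n

  dP : Vertex → Vertex → ℕ
  dP (i , b) (k , e) = dC i k + dK b e

  liftWalk : ∀ {i k L} b → Walk C i k L → Walk P (i , b) (k , b) L
  liftWalk b nil = nil
  liftWalk b (cons a w) = cons (inj₂ (refl , a)) (liftWalk b w)

  prismWalk : ∀ x y → Walk P x y (dP x y)
  prismWalk (i , F.zero) (k , F.zero) = subst (Walk P _ _) (sym (+-identityʳ _)) (liftWalk F.zero (cycleWalk i k))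
  prismWalk (i , F.zero) (k , F.suc F.zero) = concatWalk (liftWalk F.zero (cycleWalk i k)) (cons (inj₁ (refl , λ ())) nil)
  prismWalk (i , F.suc F.zero) (k , F.zero) = concatWalk (liftWalk (F.suc F.zero) (cycleWalk i k)) (cons (inj₁ (refl , λ ())) nil)
  prismWalk (i , F.suc F.zero) (k , F.suc F.zero) = subst (Walk P _ _) (sym (+-identityʳ _)) (liftWalk (F.suc F.zero) (cycleWalk i k))

  dP-adj : ∀ {p q : Vertex} (t : Vertex) → Adj P p q → dP p t ≤ suc (dP q t)
  dP-adj {i , b} {j , b'} (k , e) (inj₁ (refl , _)) =
    ≤-trans (+-monoʳ-≤ (dC i k) (≤-trans (dK≤1 b e) (s≤s z≤n))) (≤-reflexive (+-suc (dC i k) (dK b' e)))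
  dP-adj {i , b} {j , b'} (k , e) (inj₂ (refl , a)) = +-monoˡ-≤ (dK b e) (dC-adj k a)

  dP-self : ∀ x → dP x x ≡ 0
  dP-self (i , b) rewrite cycleDist-self n (toℕ i) | dK-self b = refl

  dP≤walk : ∀ {p t : Vertex} {L} → Walk P p t L → dP p t ≤ L
  dP≤walk {p} nil = ≤-reflexive (dP-self p)
  dP≤walk {t = t} (cons a w) = ≤-trans (dP-adj t a) (s≤s (dP≤walk w))

  dP-isDist : ∀ x y → Dist P x y (dP x y)
  dP-isDist x y = prismWalk x y , λ _ w → dP≤walk w

  Dist⇒dP : ∀ {x y k} → Dist P x y k → k ≡ dP x y
  Dist⇒dP {x} {y} D = ≤-antisym (proj₂ D _ (prismWalk x y)) (dP≤walk (proj₁ D))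

  _≟ᵛ_ : DecidableEquality Vertex
  _≟ᵛ_ = ≡-dec F._≟_ F._≟_

  open import Data.List.Membership.DecPropositional _≟ᵛ_ using (_∈?_)

  Equidistant : Vertex → Vertex → Vertex → Set
  Equidistant x y w = dP x w ≡ dP y w

  Equalized : List Vertex → Vertex → Vertex → Set
  Equalized D x y = Σ Vertex λ w → w ∈ D × Equidistant x y w

  Equalized-sym : ∀ {D x y} → Equalized D y x → Equalized D x y
  Equalized-sym (w , w∈D , e) = w , w∈D , sym e

  isDistanceEqualizer : ∀ D → (∀ x y → x ≢ y → x ∉ D → y ∉ D → Equalized D x y) → IsDistanceEqualizer P D
  isDistanceEqualizer D h x y x≢y x∉D y∉D with h x y x≢y x∉D y∉D
  ... | w , w∈D , e = w , w∈D , dP x w , dP-isDist x w , subst (Dist P y w) (sym e) (dP-isDist y w)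

  equalize : ∀ {D} → IsDistanceEqualizer P D → ∀ {x y} → x ≢ y → x ∉ D → y ∉ D → Equalized D x y
  equalize isDE x≢y x∉D y∉D with isDE _ _ x≢y x∉D y∉D
  ... | w , w∈D , k , d₁ , d₂ = w , w∈D , trans (sym (Dist⇒dP d₁)) (Dist⇒dP d₂)

  -- The two ends of a rung are at distances differing by exactly one from every vertex.
  rung∩D : ∀ {D} → IsDistanceEqualizer P D → ∀ i → ((i , ℓ₀) ∈ D) ⊎ ((i , ℓ₁) ∈ D)
  rung∩D {D} isDE i with (i , ℓ₀) ∈? D | (i , ℓ₁) ∈? D
  ... | yes p | _ = inj₁ p
  ... | no _ | yes p = inj₂ p
  ... | no ∉₀ | no ∉₁ with equalize isDE {i , ℓ₀} {i , ℓ₁} (λ ()) ∉₀ ∉₁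
  ...   | (k , e) , _ , eq = ⊥-elim (dK-ℓ₀≢ℓ₁ e (+-cancelˡ-≡ (dC i k) _ _ eq))
    where
    dK-ℓ₀≢ℓ₁ : ∀ e → dK ℓ₀ e ≢ dK ℓ₁ e
    dK-ℓ₀≢ℓ₁ F.zero ()
    dK-ℓ₀≢ℓ₁ (F.suc F.zero) ()

  n≤length : ∀ D → IsDistanceEqualizer P D → n ≤ length D
  n≤length D isDE = subst (_≤ length D) (length-tabulate rep)
    (Unique⇒length≤ _≟ᵛ_ (tabulate⁺ rep-injective) rep∈D)
    where
    rep : Fin n → Vertex
    rep i with rung∩D isDE i
    ... | inj₁ _ = i , ℓ₀
    ... | inj₂ _ = i , ℓ₁
    rep-fst : ∀ i → proj₁ (rep i) ≡ i
    rep-fst i with rung∩D isDE i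
    ... | inj₁ _ = refl
    ... | inj₂ _ = refl
    rep-injective : ∀ {i j} → rep i ≡ rep j → i ≡ j
    rep-injective {i} {j} e = trans (sym (rep-fst i)) (trans (cong proj₁ e) (rep-fst j))
    rep∈D : ∀ {z} → z ∈ tabulate rep → z ∈ D
    rep∈D z∈ with ∈-tabulate⁻ {f = rep} z∈
    ... | i , refl with rung∩D isDE i
    ...   | inj₁ p = p
    ...   | inj₂ p = p

  bit : Fin 2 → Bool
  bit F.zero = false
  bit (F.suc F.zero) = true

  -- A proper 2-colouring of the prism when n is even.
  colour : Vertex → Bool
  colour (i , b) = isOdd (toℕ i) xor bit b

  dK-≢ : ∀ {b c} → b ≢ c → dK b c ≡ 1
  dK-≢ {F.zero} {F.zero} b≢c = ⊥-elim (b≢c refl)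
  dK-≢ {F.zero} {F.suc F.zero} _ = refl
  dK-≢ {F.suc F.zero} {F.zero} _ = refl
  dK-≢ {F.suc F.zero} {F.suc F.zero} b≢c = ⊥-elim (b≢c refl)

  isOdd-dK : ∀ b e → isOdd (dK b e) ≡ bit b xor bit e
  isOdd-dK F.zero F.zero = refl
  isOdd-dK F.zero (F.suc F.zero) = refl
  isOdd-dK (F.suc F.zero) F.zero = refl
  isOdd-dK (F.suc F.zero) (F.suc F.zero) = refl

  isOdd-dP : isOdd n ≡ false → ∀ x y → isOdd (dP x y) ≡ colour x xor colour y
  isOdd-dP even-n (i , b) (k , e) = begin
    isOdd (dC i k + dK b e)                                 ≡⟨ isOdd-+ (dC i k) (dK b e) ⟩
    isOdd (dC i k) xor isOdd (dK b e)                       ≡⟨ cong₂ _xor_ (isOdd-cycleDist n _ _ even-n (<⇒≤ (toℕ<n i)) (<⇒≤ (toℕ<n k)))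
                                                                           (isOdd-dK b e) ⟩
    (isOdd (toℕ i) xor isOdd (toℕ k)) xor (bit b xor bit e) ≡⟨ interchange (isOdd (toℕ i)) (isOdd (toℕ k)) (bit b) (bit e) ⟩
    colour (i , b) xor colour (k , e)                       ∎
    where open ≡-Reasoning

  dP-≡ : ∀ {i j k b c e A B} → dC i k ≡ A → dC j k ≡ B → A + dK b e ≡ B + dK c e → dP (i , b) (k , e) ≡ dP (j , c) (k , e)
  dP-≡ p q r rewrite p | q = r

  midpoint : ∀ {i j h} → toℕ j ≡ toℕ i + (h + h) → Σ (Fin n) λ k → dC i k ≡ dC j k
  midpoint {i} {j} {h} e = fromℕ< lt ,
      trans (cycleDist-ahead h≤n (inj₁ (toℕ-fromℕ< lt)))
            (sym (cycleDist-behind h≤n (inj₁ (trans e (trans (sym (+-assoc (toℕ i) h h)) (cong (_+ h) (sym (toℕ-fromℕ< lt))))))))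
    where
    lt : toℕ i + h < n
    lt = ≤-<-trans (subst (toℕ i + h ≤_) (trans (+-assoc (toℕ i) h h) (sym e)) (m≤m+n (toℕ i + h) h)) (toℕ<n j)
    h≤n : h ≤ n
    h≤n = ≤-trans (m≤n+m h (toℕ i)) (<⇒≤ lt)

  midpoint-around : ∀ {i j d h} → toℕ j ≡ toℕ i + d → n ≡ d + (h + h) → Σ (Fin n) λ k → dC i k ≡ dC j k
  midpoint-around {i} {j} {d} {h} e en with reduce {n} (toℕ j) h (toℕ<n j) h≤n
    where
    h≤n : h ≤ n
    h≤n = ≤-trans (m≤m+n h h) (subst ((h + h) ≤_) (sym en) (m≤n+m (h + h) d))
  ... | k , k<n , red = fromℕ< k<n ,
      trans (cycleDist-ahead {n} {toℕ i} d+h≤n (subst (λ z → Reduces n z (toℕ (fromℕ< k<n))) j+h≡i+[d+h] red′))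
       (trans (arcDist-complement {n} {d + h} {h} (trans (+-assoc d h h) (sym en)))
         (sym (cycleDist-ahead h≤n red′)))
    where
    h≤n : h ≤ n
    h≤n = ≤-trans (m≤m+n h h) (subst ((h + h) ≤_) (sym en) (m≤n+m (h + h) d))
    d+h≤n : d + h ≤ n
    d+h≤n = subst (d + h ≤_) (trans (+-assoc d h h) (sym en)) (m≤m+n (d + h) h)
    j+h≡i+[d+h] : toℕ j + h ≡ toℕ i + (d + h)
    j+h≡i+[d+h] = trans (cong (_+ h) e) (+-assoc (toℕ i) d h)
    red′ : Reduces n (toℕ j + h) (toℕ (fromℕ< k<n))
    red′ rewrite toℕ-fromℕ< k<n = red

  -- Rungs i and j split C_n into arcs of odd lengths 2t+1 (from i to j) and 2t'+1 (from j to i).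
  -- On each arc there are two rungs whose distances to i and j differ by exactly one.
  module OddGap {i j : Fin n} {t t' : ℕ} (ej : toℕ j ≡ toℕ i + suc (t + t)) (en : n ≡ suc (t + t) + suc (t' + t')) where

    private
      ≤n : ∀ {a} → a ≤ suc (t + t) + suc (t' + t') → a ≤ n
      ≤n {a} p = subst (a ≤_) (sym en) p

      t≤ : t ≤ suc (t + t) + suc (t' + t')
      t≤ = ≤-trans (n≤1+n t) (≤-trans (m≤m+n (suc t) t) (m≤m+n (suc (t + t)) _))

      1+t≤ : suc t ≤ suc (t + t) + suc (t' + t')
      1+t≤ = ≤-trans (m≤m+n (suc t) t) (m≤m+n (suc (t + t)) _)

      t′≤ : t' ≤ suc (t + t) + suc (t' + t')
      t′≤ = ≤-trans (m≤m+n t' t') (≤-trans (n≤1+n _) (m≤n+m _ (suc (t + t))))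

      1+t′≤ : suc t' ≤ suc (t + t) + suc (t' + t')
      1+t′≤ = ≤-trans (s≤s (m≤m+n t' t')) (m≤n+m _ (suc (t + t)))

      arc : ∀ {a} b → a + b ≡ suc (t + t) + suc (t' + t') → a ≤ b → arcDist n a ≡ a
      arc b e = arcDist-short {n} {_} {b} (trans e (sym en))

      arcᶜ : ∀ {a} b → a + b ≡ suc (t + t) + suc (t' + t') → b ≤ a → arcDist n a ≡ b
      arcᶜ {a} b e = arcDist-long {n} {a} {b} (trans e (sym en))

      ring₁ : ∀ t t' → t + (suc t + suc (t' + t')) ≡ suc (t + t) + suc (t' + t')
      ring₁ = solve-∀
      ring₂ : ∀ t t' → suc t + (t + suc (t' + t')) ≡ suc (t + t) + suc (t' + t')
      ring₂ = solve-∀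
      ring₃ : ∀ t t' → t' + (suc (t + t) + suc t') ≡ suc (t + t) + suc (t' + t')
      ring₃ = solve-∀
      ring₄ : ∀ t t' → suc t' + (suc (t + t) + t') ≡ suc (t + t) + suc (t' + t')
      ring₄ = solve-∀
      ring₅ : ∀ t t' → (suc (t + t) + t') + suc t' ≡ suc (t + t) + suc (t' + t')
      ring₅ = solve-∀
      ring₆ : ∀ t t' → (suc (t + t) + suc t') + t' ≡ suc (t + t) + suc (t' + t')
      ring₆ = solve-∀

      arc-t : arcDist n t ≡ t
      arc-t = arc (suc t + suc (t' + t')) (ring₁ t t') (≤-trans (n≤1+n t) (m≤m+n (suc t) _))
      arc-1+t : arcDist n (suc t) ≡ suc t
      arc-1+t = arc (t + suc (t' + t')) (ring₂ t t')
        (≤-trans (s≤s (m≤m+n t (t' + t'))) (≤-reflexive (sym (+-suc t (t' + t')))))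
      arc-t′ : arcDist n t' ≡ t'
      arc-t′ = arc (suc (t + t) + suc t') (ring₃ t t') (≤-trans (n≤1+n t') (m≤n+m (suc t') (suc (t + t))))
      arc-1+t′ : arcDist n (suc t') ≡ suc t'
      arc-1+t′ = arc (suc (t + t) + t') (ring₄ t t') (s≤s (m≤n+m t' (t + t)))
      arc-2t+1+t′ : arcDist n (suc (t + t) + t') ≡ suc t'
      arc-2t+1+t′ = arcᶜ (suc t') (ring₅ t t') (s≤s (m≤n+m t' (t + t)))
      arc-2t+2+t′ : arcDist n (suc (t + t) + suc t') ≡ t'
      arc-2t+2+t′ = arcᶜ t' (ring₆ t t') (≤-trans (n≤1+n t') (m≤n+m (suc t') (suc (t + t))))

      j+t′≡ : ∀ {k a} → Reduces n (toℕ j + a) k → Reduces n (toℕ i + (suc (t + t) + a)) k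
      j+t′≡ {k} {a} = subst (λ z → Reduces n z k) (trans (cong (_+ a) ej) (+-assoc (toℕ i) (suc (t + t)) a))

      j≡ : ∀ a b → a + b ≡ suc (t + t) → toℕ j ≡ (toℕ i + a) + b
      j≡ a b e = trans ej (trans (cong (toℕ i +_) (sym e)) (sym (+-assoc (toℕ i) a b)))

      i+a<n : ∀ {a} → a ≤ suc (t + t) → toℕ i + a < n
      i+a<n {a} a≤ = ≤-<-trans (subst (toℕ i + a ≤_) (sym ej) (+-monoʳ-≤ (toℕ i) a≤)) (toℕ<n j)

    shortNearJ : Σ (Fin n) λ k → (toℕ k ≡ toℕ i + suc t) × (dC i k ≡ suc t) × (dC j k ≡ t)
    shortNearJ = fromℕ< lt , toℕ-fromℕ< lt ,
      trans (cycleDist-ahead (≤n 1+t≤) (inj₁ (toℕ-fromℕ< lt))) arc-1+t ,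
      trans (cycleDist-behind (≤n t≤) (inj₁ (trans (j≡ (suc t) t refl) (cong (_+ t) (sym (toℕ-fromℕ< lt)))))) arc-t
      where
      lt : toℕ i + suc t < n
      lt = i+a<n (s≤s (m≤m+n t t))

    shortNearI : Σ (Fin n) λ k → (toℕ k ≡ toℕ i + t) × (dC i k ≡ t) × (dC j k ≡ suc t)
    shortNearI = fromℕ< lt , toℕ-fromℕ< lt ,
      trans (cycleDist-ahead (≤n t≤) (inj₁ (toℕ-fromℕ< lt))) arc-t ,
      trans (cycleDist-behind (≤n 1+t≤) (inj₁ (trans (j≡ t (suc t) (+-suc t t)) (cong (_+ suc t) (sym (toℕ-fromℕ< lt)))))) arc-1+t
      where
      lt : toℕ i + t < n
      lt = i+a<n (≤-trans (m≤m+n t t) (n≤1+n _))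

    longNearJ : Σ (Fin n) λ k → Reduces n (toℕ j + t') (toℕ k) × (dC i k ≡ suc t') × (dC j k ≡ t')
    longNearJ with reduce {n} (toℕ j) t' (toℕ<n j) (≤n t′≤)
    ... | k , k<n , red = fromℕ< k<n , red′ ,
          trans (cycleDist-ahead (≤n (+-monoʳ-≤ (suc (t + t)) (≤-trans (m≤m+n t' t') (n≤1+n _)))) (j+t′≡ red′)) arc-2t+1+t′ ,
          trans (cycleDist-ahead (≤n t′≤) red′) arc-t′
      where
      red′ : Reduces n (toℕ j + t') (toℕ (fromℕ< k<n))
      red′ rewrite toℕ-fromℕ< k<n = red

    longNearI : Σ (Fin n) λ k → Reduces n (toℕ j + suc t') (toℕ k) × (dC i k ≡ t') × (dC j k ≡ suc t')
    longNearI with reduce {n} (toℕ j) (suc t') (toℕ<n j) (≤n 1+t′≤)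
    ... | k , k<n , red = fromℕ< k<n , red′ ,
          trans (cycleDist-ahead (≤n (+-monoʳ-≤ (suc (t + t)) (s≤s (m≤m+n t' t')))) (j+t′≡ red′)) arc-2t+2+t′ ,
          trans (cycleDist-ahead (≤n 1+t′≤) red′) arc-1+t′
      where
      red′ : Reduces n (toℕ j + suc t') (toℕ (fromℕ< k<n))
      red′ rewrite toℕ-fromℕ< k<n = red

  gap≤n : ∀ {i d} (j : Fin n) → toℕ j ≡ i + d → d ≤ n
  gap≤n {i} {d} j ej = ≤-trans (m≤n+m d i) (≤-trans (≤-reflexive (sym ej)) (<⇒≤ (toℕ<n j)))

  -- For odd n one of the two arcs between any two rungs has even length.
  oddCycle-equidistantʳ : isOdd n ≡ true → ∀ (i j : Fin n) d → toℕ j ≡ toℕ i + d → Σ (Fin n) λ k → dC i k ≡ dC j k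
  oddCycle-equidistantʳ odd-n i j d ej with isOdd d in odd-d
  ... | false with even⇒double d odd-d
  ...   | h , refl = midpoint {i} {j} {h} ej
  oddCycle-equidistantʳ odd-n i j d ej | true with even⇒double (n ∸ d) even-n∸d
    where
    even-n∸d : isOdd (n ∸ d) ≡ false
    even-n∸d = trans (isOdd-∸ n d (gap≤n {toℕ i} j ej)) (cong₂ _xor_ odd-n odd-d)
  ... | h , eh = midpoint-around {i} {j} {d} {h} ej (trans (sym (m+[n∸m]≡n (gap≤n {toℕ i} j ej))) (cong (d +_) eh))

  oddCycle-equidistant : isOdd n ≡ true → ∀ i j → Σ (Fin n) λ k → dC i k ≡ dC j k
  oddCycle-equidistant odd-n i j with ≤-total (toℕ i) (toℕ j)
  ... | inj₁ i≤j = oddCycle-equidistantʳ odd-n i j _ (proj₂ (≤⇒∃+ i≤j))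
  ... | inj₂ j≤i with oddCycle-equidistantʳ odd-n j i _ (proj₂ (≤⇒∃+ j≤i))
  ...   | k , e = k , sym e

  module OddCycle (odd-n : isOdd n ≡ true) where

    layer₀ : List Vertex
    layer₀ = tabulate (_, ℓ₀)

    ∈layer₀ : ∀ k → (k , ℓ₀) ∈ layer₀
    ∈layer₀ = ∈-tabulate⁺ {f = _, ℓ₀}

    layer₀-isDistanceEqualizer : IsDistanceEqualizer P layer₀
    layer₀-isDistanceEqualizer = isDistanceEqualizer layer₀ equalized
      where
      equalized : ∀ x y → x ≢ y → x ∉ layer₀ → y ∉ layer₀ → Equalized layer₀ x y
      equalized (i , F.zero) _ _ x∉ _ = ⊥-elim (x∉ (∈layer₀ i))
      equalized _ (j , F.zero) _ _ y∉ = ⊥-elim (y∉ (∈layer₀ j))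
      equalized (i , F.suc F.zero) (j , F.suc F.zero) _ _ _ with oddCycle-equidistant odd-n i j
      ... | k , e = (k , ℓ₀) , ∈layer₀ k , cong (_+ 1) e

    layer₀-unique : Unique layer₀
    layer₀-unique = tabulate⁺ {f = _, ℓ₀} (cong proj₁)

    length-layer₀ : length layer₀ ≡ n
    length-layer₀ = length-tabulate (_, ℓ₀)

  byOrderedRungs : ∀ (D : List Vertex) (X : Vertex → Set) →
    (∀ {i b c} → X (i , b) → X (i , c) → b ≡ c) →
    (∀ {i j b c} → toℕ i < toℕ j → X (i , b) → X (j , c) → Equalized D (i , b) (j , c)) →
    ∀ {x y} → x ≢ y → X x → X y → Equalized D x y
  byOrderedRungs D X oneOnRung ordered {i , b} {j , c} x≢y x y with <-cmp (toℕ i) (toℕ j)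
  ... | tri< i<j _ _ = ordered i<j x y
  ... | tri> _ _ j<i = Equalized-sym {D} {i , b} {j , c} (ordered j<i y x)
  ... | tri≈ _ i≡j _ with toℕ-injective i≡j
  ...   | refl = ⊥-elim (x≢y (cong (i ,_) (oneOnRung x y)))

  blackLayer : Fin n → Fin 2
  blackLayer k with isOdd (toℕ k)
  ... | true = ℓ₀
  ... | false = ℓ₁

  blackVertex : Fin n → Vertex
  blackVertex k = k , blackLayer k

  colour-blackVertex : ∀ k → colour (blackVertex k) ≡ true
  colour-blackVertex k with isOdd (toℕ k)
  ... | true = refl
  ... | false = refl

  colour-injectiveʳ : ∀ {i b c} → colour (i , b) ≡ colour (i , c) → b ≡ c
  colour-injectiveʳ {i} {b} {c} e = bit-injective (∙-cancelˡ (isOdd (toℕ i)) (bit b) (bit c) e)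
    where
    bit-injective : ∀ {b c} → bit b ≡ bit c → b ≡ c
    bit-injective {F.zero} {F.zero} _ = refl
    bit-injective {F.suc F.zero} {F.suc F.zero} _ = refl
    bit-injective {F.zero} {F.suc F.zero} ()
    bit-injective {F.suc F.zero} {F.zero} ()

  black : List Vertex
  black = tabulate blackVertex

  black-unique : Unique black
  black-unique = tabulate⁺ {f = blackVertex} (cong proj₁)

  length-black : length black ≡ n
  length-black = length-tabulate blackVertex

  colour≡true⇒∈black : ∀ {w} → colour w ≡ true → w ∈ black
  colour≡true⇒∈black {k , e} c = subst (_∈ black) (cong (k ,_) (colour-injectiveʳ {k} (trans (colour-blackVertex k) (sym c))))
    (∈-tabulate⁺ {f = blackVertex} k)

  ∉black⇒white : ∀ {w} → w ∉ black → colour w ≡ false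
  ∉black⇒white {w} w∉ with colour w in cw
  ... | true = ⊥-elim (w∉ (colour≡true⇒∈black cw))
  ... | false = refl

  colour≡isOdd-dP : isOdd n ≡ false → ∀ {x w} → colour x ≡ false → colour w ≡ isOdd (dP x w)
  colour≡isOdd-dP even-n {x} {w} cx = sym (trans (isOdd-dP even-n x w) (cong (_xor colour w) cx))

  isOdd-gap : isOdd n ≡ false → ∀ {i j : Fin n} {b c d} → colour (i , b) ≡ false → colour (j , c) ≡ false →
    toℕ j ≡ toℕ i + d → isOdd d ≡ bit b xor bit c
  isOdd-gap even-n {i} {j} {b} {c} {d} cx cy ej = x∙y⁻¹≈ε⇒x≈y (isOdd d) (bit b xor bit c) (begin
    isOdd d xor (bit b xor bit c)                 ≡⟨ cong₂ _xor_ (isOdd-arcDist n d even-n (gap≤n {toℕ i} j ej)) (isOdd-dK b c) ⟨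
    isOdd (arcDist n d) xor isOdd (dK b c)        ≡⟨ cong (λ z → isOdd z xor isOdd (dK b c)) (cycleDist-ahead (gap≤n {toℕ i} j ej) (inj₁ ej)) ⟨
    isOdd (dC i j) xor isOdd (dK b c)             ≡⟨ isOdd-+ (dC i j) (dK b c) ⟨
    isOdd (dP (i , b) (j , c))                    ≡⟨ isOdd-dP even-n (i , b) (j , c) ⟩
    colour (i , b) xor colour (j , c)             ≡⟨ cong₂ _xor_ cx cy ⟩
    false                                         ∎)
    where open ≡-Reasoning

  OddArcs : Fin n → Fin n → Set
  OddArcs i j = Σ ℕ λ t → Σ ℕ λ t' → (toℕ j ≡ toℕ i + suc (t + t)) × (n ≡ suc (t + t) + suc (t' + t'))

  module EvenCycle (even-n : isOdd n ≡ false) (D : List Vertex) (black⊆D : ∀ {w} → w ∈ black → w ∈ D) where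

    sameLayer : ∀ {i j : Fin n} {b d} → colour (i , b) ≡ false → colour (j , b) ≡ false →
      toℕ j ≡ toℕ i + d → Equalized D (i , b) (j , b)
    sameLayer {i} {j} {b} {d} cx cy ej = aboveMidpoint (even⇒double d even-d)
      where
      even-d : isOdd d ≡ false
      even-d = trans (isOdd-gap even-n {i} {j} {b} {b} cx cy ej) (xor-same (bit b))
      aboveMidpoint : Σ ℕ (λ h → d ≡ h + h) → Equalized D (i , b) (j , b)
      aboveMidpoint (h , refl) with midpoint {i} {j} {h} ej
      ... | k , e = blackVertex k , black⊆D (∈-tabulate⁺ {f = blackVertex} k) , cong (_+ dK b (blackLayer k)) e

    oddGap : ∀ {i j : Fin n} {b c d} → colour (i , b) ≡ false → colour (j , c) ≡ false → b ≢ c → toℕ j ≡ toℕ i + d →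
      OddArcs i j
    oddGap {i} {j} {b} {c} {d} cx cy b≢c ej = split (odd⇒suc-double d odd-d)
      where
      bit-≢ : ∀ {b c} → b ≢ c → bit b xor bit c ≡ true
      bit-≢ {F.zero} {F.zero} b≢c = ⊥-elim (b≢c refl)
      bit-≢ {F.zero} {F.suc F.zero} _ = refl
      bit-≢ {F.suc F.zero} {F.zero} _ = refl
      bit-≢ {F.suc F.zero} {F.suc F.zero} b≢c = ⊥-elim (b≢c refl)
      odd-d : isOdd d ≡ true
      odd-d = trans (isOdd-gap even-n {i} {j} {b} {c} cx cy ej) (bit-≢ b≢c)
      d≤n : d ≤ n
      d≤n = gap≤n {toℕ i} j ej
      odd-rest : isOdd (n ∸ d) ≡ true
      odd-rest = trans (isOdd-∸ n d d≤n) (cong₂ _xor_ even-n odd-d)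
      split : Σ ℕ (λ t → d ≡ suc (t + t)) → OddArcs i j
      split (t , refl) = t , proj₁ rest , ej , trans (sym (m+[n∸m]≡n d≤n)) (cong (suc (t + t) +_) (proj₂ rest))
        where
        rest : Σ ℕ λ t' → n ∸ suc (t + t) ≡ suc (t' + t')
        rest = odd⇒suc-double (n ∸ suc (t + t)) odd-rest

    -- Each of the four rungs of OddGap carries an equalizer of (i , b) and (j , c); its colour is
    -- the parity of its distance to the white vertex (i , b).
    module OddPair {i j : Fin n} {b c : Fin 2} {t t' : ℕ} (cx : colour (i , b) ≡ false) (b≢c : b ≢ c)
                   (ej : toℕ j ≡ toℕ i + suc (t + t)) (en : n ≡ suc (t + t) + suc (t' + t')) where
      open OddGap {i} {j} {t} {t'} ej en

      private
        colour-at : ∀ {k e} a → dP (i , b) (k , e) ≡ suc a → colour (k , e) ≡ not (isOdd a)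
        colour-at {k} {e} a d≡ = trans (colour≡isOdd-dP even-n {i , b} {k , e} cx) (cong isOdd d≡)

        a+0≡a+1 : ∀ {e} a → dK b e ≡ 0 → dK c e ≡ 1 → suc a + dK b e ≡ a + dK c e
        a+0≡a+1 a e₀ e₁ rewrite e₀ | e₁ = trans (cong suc (+-identityʳ a)) (+-comm 1 a)

        a+1≡a+0 : ∀ {e} a → dK b e ≡ 1 → dK c e ≡ 0 → a + dK b e ≡ suc a + dK c e
        a+1≡a+0 a e₁ e₀ rewrite e₀ | e₁ = sym (trans (cong suc (+-identityʳ a)) (+-comm 1 a))

      onShortNearJ : Σ Vertex λ w → Equidistant (i , b) (j , c) w × (colour w ≡ not (isOdd t))
      onShortNearJ with shortNearJ
      ... | k , _ , di , dj = (k , b) , dP-≡ {i} {j} {k} {b} {c} {b} di dj (a+0≡a+1 t (dK-self b) (dK-≢ (λ e → b≢c (sym e)))) ,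
            colour-at t (trans (cong₂ _+_ di (dK-self b)) (cong suc (+-identityʳ t)))

      onShortNearI : Σ (Fin n) λ k → (toℕ k ≡ toℕ i + t) × Equidistant (i , b) (j , c) (k , c) × (colour (k , c) ≡ not (isOdd t))
      onShortNearI with shortNearI
      ... | k , pos , di , dj = k , pos , dP-≡ {i} {j} {k} {b} {c} {c} di dj (a+1≡a+0 t (dK-≢ b≢c) (dK-self c)) ,
            colour-at t (trans (cong₂ _+_ di (dK-≢ b≢c)) (+-comm t 1))

      onLongNearJ : Σ (Fin n) λ k → Reduces n (toℕ j + t') (toℕ k) × Equidistant (i , b) (j , c) (k , b) × (colour (k , b) ≡ not (isOdd t'))
      onLongNearJ with longNearJ
      ... | k , pos , di , dj = k , pos , dP-≡ {i} {j} {k} {b} {c} {b} di dj (a+0≡a+1 t' (dK-self b) (dK-≢ (λ e → b≢c (sym e)))) ,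
            colour-at t' (trans (cong₂ _+_ di (dK-self b)) (cong suc (+-identityʳ t')))

      onLongNearI : Σ (Fin n) λ k → Reduces n (toℕ j + suc t') (toℕ k) × Equidistant (i , b) (j , c) (k , c) × (colour (k , c) ≡ not (isOdd t'))
      onLongNearI with longNearI
      ... | k , pos , di , dj = k , pos , dP-≡ {i} {j} {k} {b} {c} {c} di dj (a+1≡a+0 t' (dK-≢ b≢c) (dK-self c)) ,
            colour-at t' (trans (cong₂ _+_ di (dK-≢ b≢c)) (+-comm t' 1))

  module ZeroMod4 (q : ℕ) (n≡4q : n ≡ (q + q) + (q + q)) where

    private
      even-n : isOdd n ≡ false
      even-n = trans (cong isOdd n≡4q) (isOdd-double (q + q))

    open EvenCycle even-n black (λ w∈ → w∈)

    black-isDistanceEqualizer : IsDistanceEqualizer P black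
    black-isDistanceEqualizer = isDistanceEqualizer black (λ x y x≢y x∉ y∉ →
      byOrderedRungs black (λ z → colour z ≡ false) (λ {i} cx cy → colour-injectiveʳ {i} (trans cx (sym cy)))
        ordered x≢y (∉black⇒white x∉) (∉black⇒white y∉))
      where
      ordered : ∀ {i j : Fin n} {b c} → toℕ i < toℕ j → colour (i , b) ≡ false → colour (j , c) ≡ false →
        Equalized black (i , b) (j , c)
      ordered {i} {j} {b} {c} i<j cx cy with b F.≟ c
      ... | yes refl = sameLayer {i} {j} {b} cx cy (proj₂ (≤⇒∃+ (<⇒≤ i<j)))
      ... | no b≢c = differentLayers (oddGap {i} {j} {b} {c} cx cy b≢c (proj₂ (≤⇒∃+ (<⇒≤ i<j))))
        where
        differentLayers : OddArcs i j → Equalized black (i , b) (j , c)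
        differentLayers (t , t' , ej , en) with isOdd t in odd-t
        ... | false = let w , e , cw = OddPair.onShortNearJ {i} {j} {b} {c} {t} {t'} cx b≢c ej en
                      in w , colour≡true⇒∈black (trans cw (cong not odd-t)) , e
        ... | true = let k , _ , e , cw = OddPair.onLongNearJ {i} {j} {b} {c} {t} {t'} cx b≢c ej en
                     in (k , b) , colour≡true⇒∈black (trans cw (cong not t′-even)) , e
          where
          1+t+t′≡2q : suc (t + t') ≡ q + q
          1+t+t′≡2q = double-injective (trans (sym ([1+2t]+[1+2t′]≡2[1+t+t′] t t')) (trans (sym en) n≡4q))
          t′-even : isOdd t' ≡ false
          t′-even with isOdd t' in odd-t′
          ... | false = refl
          ... | true with () ← trans (sym (isOdd-double q)) (trans (cong isOdd (sym 1+t+t′≡2q))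
                                (cong not (trans (isOdd-+ t t') (cong₂ _xor_ odd-t odd-t′))))

  module TwoMod4 (m : ℕ) (n≡4m+2 : n ≡ suc (suc ((m + m) + (m + m)))) where

    M : ℕ
    M = m + m

    even-n : isOdd n ≡ false
    even-n = trans (cong isOdd n≡4m+2) (trans (not-involutive _) (isOdd-double M))

    2a<n : (a : Fin m) → toℕ a + toℕ a < n
    2a<n a = ≤-trans (+-mono-< (toℕ<n a) (toℕ<n a))
      (≤-trans (m≤m+n M M) (≤-trans (n≤1+n _) (≤-trans (n≤1+n _) (≤-reflexive (sym n≡4m+2)))))

    lowWhite : Fin m → Vertex
    lowWhite a = fromℕ< (2a<n a) , ℓ₀

    colour-lowWhite : ∀ a → colour (lowWhite a) ≡ false
    colour-lowWhite a rewrite toℕ-fromℕ< (2a<n a) = trans (xor-identityʳ _) (isOdd-double (toℕ a))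

    D : List Vertex
    D = black ++ tabulate lowWhite

    black⊆D : ∀ {w} → w ∈ black → w ∈ D
    black⊆D = ∈-++⁺ˡ

    white-low∈D : ∀ {k} → colour (k , ℓ₀) ≡ false → toℕ k < M → (k , ℓ₀) ∈ D
    white-low∈D {k} white k<M with even⇒double (toℕ k) (trans (sym (xor-identityʳ (isOdd (toℕ k)))) white)
    ... | h , k≡2h = ∈-++⁺ʳ black (subst (_∈ tabulate lowWhite) lowWhite-a≡k (∈-tabulate⁺ {f = lowWhite} a))
      where
      h<m : h < m
      h<m with h <? m
      ... | yes p = p
      ... | no p = ⊥-elim (<-irrefl refl (≤-<-trans (+-mono-≤ (≮⇒≥ p) (≮⇒≥ p)) (subst (_< M) k≡2h k<M)))
      a : Fin m
      a = fromℕ< h<m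
      lowWhite-a≡k : lowWhite a ≡ (k , ℓ₀)
      lowWhite-a≡k = cong (_, ℓ₀) (toℕ-injective (trans (toℕ-fromℕ< (2a<n a))
        (trans (cong₂ _+_ (toℕ-fromℕ< h<m) (toℕ-fromℕ< h<m)) (sym k≡2h))))

    Outside : Vertex → Set
    Outside x = (colour x ≡ false) × (proj₂ x ≡ ℓ₀ → M ≤ toℕ (proj₁ x))

    ∉D⇒Outside : ∀ {x} → x ∉ D → Outside x
    ∉D⇒Outside {i , b} x∉ = white , high
      where
      white : colour (i , b) ≡ false
      white = ∉black⇒white (λ p → x∉ (black⊆D p))
      high : b ≡ ℓ₀ → M ≤ toℕ i
      high refl with toℕ i <? M
      ... | yes p = ⊥-elim (x∉ (white-low∈D white p))
      ... | no p = ≮⇒≥ p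

    D-unique : Unique D
    D-unique = ++⁺ black-unique (tabulate⁺ {f = lowWhite} lowWhite-injective) disjoint
      where
      lowWhite-injective : ∀ {a a'} → lowWhite a ≡ lowWhite a' → a ≡ a'
      lowWhite-injective {a} {a'} e = toℕ-injective (double-injective
        (trans (sym (toℕ-fromℕ< (2a<n a))) (trans (cong (λ z → toℕ (proj₁ z)) e) (toℕ-fromℕ< (2a<n a')))))
      disjoint : ∀ {v} → ¬ ((v ∈ black) × (v ∈ tabulate lowWhite))
      disjoint (p , q) with ∈-tabulate⁻ {f = blackVertex} p | ∈-tabulate⁻ {f = lowWhite} q
      ... | k , refl | a , e with () ← trans (sym (colour-blackVertex k)) (trans (cong colour e) (colour-lowWhite a))

    length-D : length D ≡ n + m
    length-D = trans (length-++ black) (cong₂ _+_ length-black (length-tabulate lowWhite))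

    open EvenCycle even-n D black⊆D

    private
      odd⇒pos : ∀ {t} → isOdd t ≡ true → 1 ≤ t
      odd⇒pos {suc t} _ = s≤s z≤n

      reduces-past-n : ∀ {s k} → n ≤ s → k < n → Reduces n s k → k + n ≡ s
      reduces-past-n n≤s k<n (inj₁ refl) = ⊥-elim (<-irrefl refl (<-≤-trans k<n n≤s))
      reduces-past-n _ _ (inj₂ e) = e

      -- A vertex reached from j by wrapping around once lands below M.
      wrapped<M : ∀ {k i t t' a} → t + t' ≡ M → 1 ≤ t → a ≤ suc t' →
        i + suc (t + t) < n → k + n ≡ i + suc (t + t) + a → k < M
      wrapped<M {k} {i} {t} {t'} {a} t+t′≡M 1≤t a≤ j<n e = +-cancelʳ-< M k M (begin-strict
        k + M       ≤⟨ +-cancelʳ-≤ (suc (suc M)) (k + M) (i + t) (begin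
          k + M + suc (suc M)               ≡⟨ ring₁ k M ⟩
          k + suc (suc (M + M))             ≡⟨ cong (k +_) (sym n≡4m+2) ⟩
          k + n                             ≡⟨ e ⟩
          i + suc (t + t) + a               ≤⟨ +-monoʳ-≤ (i + suc (t + t)) a≤ ⟩
          i + suc (t + t) + suc t'          ≡⟨ ring₂ i t t' ⟩
          i + t + suc (suc (t + t'))        ≡⟨ cong (λ z → i + t + suc (suc z)) t+t′≡M ⟩
          i + t + suc (suc M)               ∎) ⟩
        i + t       <⟨ subst (_≤ i + t + t) (+-comm (i + t) 1) (+-monoʳ-≤ (i + t) 1≤t) ⟩
        i + t + t   ≤⟨ ≤-pred (≤-pred (subst₂ _≤_ (ring₃ i t) n≡4m+2 j<n)) ⟩
        M + M       ∎)
        where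
        open ≤-Reasoning
        ring₁ : ∀ k M → k + M + suc (suc M) ≡ k + suc (suc (M + M))
        ring₁ = solve-∀
        ring₂ : ∀ i t t' → i + suc (t + t) + suc t' ≡ i + t + suc (suc (t + t'))
        ring₂ = solve-∀
        ring₃ : ∀ i t → suc (i + suc (t + t)) ≡ suc (suc (i + t + t))
        ring₃ = solve-∀

      past-n : ∀ {s x} → M ≤ x → s ≡ x + suc (suc M) → n ≤ s
      past-n {s} {x} M≤x refl = subst (_≤ x + suc (suc M)) (trans (ring M) (sym n≡4m+2)) (+-monoˡ-≤ (suc (suc M)) M≤x)
        where
        ring : ∀ M → M + suc (suc M) ≡ suc (suc (M + M))
        ring = solve-∀

      odd-partner : ∀ t t' → t + t' ≡ M → isOdd t ≡ true → isOdd t' ≡ true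
      odd-partner t t' t+t′≡M odd-t with isOdd t' in odd-t′
      ... | true = refl
      ... | false with () ← trans (sym (cong₂ _xor_ odd-t odd-t′))
                              (trans (sym (isOdd-+ t t')) (trans (cong isOdd t+t′≡M) (isOdd-double m)))

      -- Both arcs have odd half-lengths t, t′: the equalizer of OddPair that is white lies on layer ℓ₀
      -- at a position below M, that is, in the added part of D.
      bothOdd : ∀ {i j : Fin n} (b c : Fin 2) {t t'} → Outside (i , b) → b ≢ c →
        toℕ j ≡ toℕ i + suc (t + t) → n ≡ suc (t + t) + suc (t' + t') → t + t' ≡ M → isOdd t ≡ true →
        Equalized D (i , b) (j , c)
      bothOdd (F.suc F.zero) (F.suc F.zero) _ b≢c _ _ _ _ = ⊥-elim (b≢c refl)
      bothOdd F.zero F.zero _ b≢c _ _ _ _ = ⊥-elim (b≢c refl)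
      bothOdd {i} {j} F.zero c {suc t₀} {t'} (cx , hx) b≢c ej en t+t′≡M odd-t =
        let k , red , e , cw = OddPair.onLongNearJ {i} {j} {ℓ₀} {c} {suc t₀} {t'} cx b≢c ej en
        in (k , ℓ₀) , white-low∈D (trans cw (cong not (odd-partner (suc t₀) t' t+t′≡M odd-t))) (k<M k red) , e
        where
        s≡ : toℕ j + t' ≡ (toℕ i + t₀) + suc (suc M)
        s≡ = trans (cong (_+ t') ej) (trans (ring (toℕ i) t₀ t') (cong (λ z → toℕ i + t₀ + suc (suc z)) t+t′≡M))
          where
          ring : ∀ i t₀ t' → i + suc (suc t₀ + suc t₀) + t' ≡ i + t₀ + suc (suc (suc t₀ + t'))
          ring = solve-∀
        k<M : ∀ k → Reduces n (toℕ j + t') (toℕ k) → toℕ k < M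
        k<M k red = wrapped<M t+t′≡M (s≤s z≤n) (n≤1+n t') (subst (_< n) ej (toℕ<n j))
          (trans (reduces-past-n (past-n (≤-trans (hx refl) (m≤m+n (toℕ i) t₀)) s≡) (toℕ<n k) red) (cong (_+ t') ej))
      bothOdd {i} {j} (F.suc F.zero) F.zero {t} {t'} (cx , _) b≢c ej en t+t′≡M odd-t with toℕ i + t <? M
      ... | yes i+t<M =
        let k , k≡i+t , e , cw = OddPair.onShortNearI {i} {j} {ℓ₁} {ℓ₀} {t} {t'} cx b≢c ej en
        in (k , ℓ₀) , white-low∈D (trans cw (cong not odd-t)) (subst (_< M) (sym k≡i+t) i+t<M) , e
      ... | no i+t≮M =
        let k , red , e , cw = OddPair.onLongNearI {i} {j} {ℓ₁} {ℓ₀} {t} {t'} cx b≢c ej en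
        in (k , ℓ₀) , white-low∈D (trans cw (cong not (odd-partner t t' t+t′≡M odd-t))) (k<M k red) , e
        where
        s≡ : toℕ j + suc t' ≡ (toℕ i + t) + suc (suc M)
        s≡ = trans (cong (_+ suc t') ej) (trans (ring (toℕ i) t t') (cong (λ z → toℕ i + t + suc (suc z)) t+t′≡M))
          where
          ring : ∀ i t t' → i + suc (t + t) + suc t' ≡ i + t + suc (suc (t + t'))
          ring = solve-∀
        k<M : ∀ k → Reduces n (toℕ j + suc t') (toℕ k) → toℕ k < M
        k<M k red = wrapped<M t+t′≡M (odd⇒pos {t} odd-t) ≤-refl (subst (_< n) ej (toℕ<n j))
          (trans (reduces-past-n (past-n (≮⇒≥ i+t≮M) s≡) (toℕ<n k) red) (cong (_+ suc t') ej))

    D-isDistanceEqualizer : IsDistanceEqualizer P D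
    D-isDistanceEqualizer = isDistanceEqualizer D (λ x y x≢y x∉ y∉ →
      byOrderedRungs D Outside (λ {i} ox oy → colour-injectiveʳ {i} (trans (proj₁ ox) (sym (proj₁ oy))))
        ordered x≢y (∉D⇒Outside x∉) (∉D⇒Outside y∉))
      where
      ordered : ∀ {i j : Fin n} {b c} → toℕ i < toℕ j → Outside (i , b) → Outside (j , c) → Equalized D (i , b) (j , c)
      ordered {i} {j} {b} {c} i<j ox oy with b F.≟ c
      ... | yes refl = sameLayer {i} {j} {b} (proj₁ ox) (proj₁ oy) (proj₂ (≤⇒∃+ (<⇒≤ i<j)))
      ... | no b≢c = differentLayers (oddGap {i} {j} {b} {c} (proj₁ ox) (proj₁ oy) b≢c (proj₂ (≤⇒∃+ (<⇒≤ i<j))))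
        where
        differentLayers : OddArcs i j → Equalized D (i , b) (j , c)
        differentLayers (t , t' , ej , en) with isOdd t in odd-t
        ... | false = let w , e , cw = OddPair.onShortNearJ {i} {j} {b} {c} {t} {t'} (proj₁ ox) b≢c ej en
                      in w , black⊆D (colour≡true⇒∈black (trans cw (cong not odd-t))) , e
        ... | true = bothOdd b c {t} {t'} ox b≢c ej en t+t′≡M odd-t
          where
          t+t′≡M : t + t' ≡ M
          t+t′≡M = double-injective (suc-injective (suc-injective
            (trans (sym ([1+2t]+[1+2t′]≡2+2[t+t′] t t')) (trans (sym en) n≡4m+2))))

-- The lower bound for n ≡ 2 (mod 4)

DifferByOne : ℕ → ℕ → Set
DifferByOne A B = (A ≡ suc B) ⊎ (B ≡ suc A)

DifferByOne-sym : ∀ {A B} → DifferByOne A B → DifferByOne B A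
DifferByOne-sym (inj₁ e) = inj₂ e
DifferByOne-sym (inj₂ e) = inj₁ e

¬DifferByOne-far : ∀ {A B K} → 2 ≤ K → A ≡ K + B → ¬ DifferByOne A B
¬DifferByOne-far {A} {B} {suc (suc K)} _ e (inj₁ e′) =
  <-irrefl refl (≤-trans (s≤s (s≤s (m≤n+m B K))) (≤-reflexive (trans (sym e) e′)))
¬DifferByOne-far {A} {B} {suc (suc K)} _ e (inj₂ e′) =
  <-irrefl refl (≤-trans (≤-reflexive (sym e′)) (≤-trans (m≤n+m B (suc (suc K))) (≤-reflexive (sym e))))
¬DifferByOne-far {K = zero} () _ _
¬DifferByOne-far {K = suc zero} (s≤s ()) _ _

Consecutive : ℕ → ℕ → ℕ → Set
Consecutive w A B = (A ≡ w × B ≡ suc w) ⊎ (A ≡ suc w × B ≡ w)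

differByOne-sum : ∀ {A B w} → A + B ≡ suc (w + w) → DifferByOne A B → Consecutive w A B
differByOne-sum {A} {B} {w} e (inj₁ refl) with double-injective {B} {w} (suc-injective e)
... | refl = inj₂ (refl , refl)
differByOne-sum {A} {B} {w} e (inj₂ refl) with double-injective {A} {w} (suc-injective (trans (sym (+-suc A A)) e))
... | refl = inj₁ (refl , refl)

2≤1+2u : ∀ {u} → isOdd u ≡ true → 2 ≤ suc (u + u)
2≤1+2u {suc u} _ = s≤s (s≤s z≤n)

module HalfCycle (M : ℕ) where

  n : ℕ
  n = suc (suc (M + M))

  arcDist-cases : ∀ δ → δ ≤ n → ((arcDist n δ ≡ δ) × (δ ≤ suc M)) ⊎ ((arcDist n δ + δ ≡ n) × (suc M < δ))
  arcDist-cases δ δ≤n with δ ≤? suc M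
  ... | yes δ≤ = inj₁ (arcDist-short (m+[n∸m]≡n δ≤n) (m+n≤o⇒m≤o∸n δ (≤-trans (+-mono-≤ δ≤ δ≤) (≤-reflexive n≡)))  , δ≤)
    where
    n≡ : suc M + suc M ≡ n
    n≡ = +-suc (suc M) M
  ... | no δ≰ = inj₂ (trans (cong (_+ δ) (arcDist-long (m+[n∸m]≡n δ≤n) n∸δ≤δ)) (m∸n+n≡m δ≤n) , ≰⇒> δ≰)
    where
    n∸δ≤δ : n ∸ δ ≤ δ
    n∸δ≤δ = ≤-trans (∸-monoʳ-≤ n (<⇒≤ (≰⇒> δ≰)))
      (≤-trans (≤-reflexive (trans (cong (_∸ suc M) (sym (+-suc (suc M) M))) (m+n∸m≡n (suc M) (suc M)))) (<⇒≤ (≰⇒> δ≰)))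

  private
    rotate : ∀ a b c → a + b + c ≡ c + a + b
    rotate = solve-∀
    swap-front : ∀ x c b → x + (c + b) ≡ c + x + b
    swap-front = solve-∀
    swap-back : ∀ x b c → x + b + c ≡ x + (c + b)
    swap-back = solve-∀

  n≡odd+odd : ∀ u U' → u + U' ≡ M → n ≡ suc (u + u) + suc (U' + U')
  n≡odd+odd u U' u+U′≡M = trans (cong (λ z → suc (suc (z + z))) (sym u+U′≡M)) (sym ([1+2t]+[1+2t′]≡2+2[t+t′] u U'))

  long-short-far : ∀ {u U' x y} → u + U' ≡ M → arcDist n x + x ≡ n → arcDist n y ≡ y → y + x ≡ suc (u + u) →
    arcDist n x ≡ suc (U' + U') + arcDist n y
  long-short-far {u} {U'} {x} {y} u+U′≡M gx gy y+x≡ = +-cancelʳ-≡ x _ _ (begin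
    arcDist n x + x                      ≡⟨ trans gx (n≡odd+odd u U' u+U′≡M) ⟩
    suc (u + u) + suc (U' + U')          ≡⟨ cong (_+ suc (U' + U')) (sym y+x≡) ⟩
    (y + x) + suc (U' + U')              ≡⟨ rotate y x (suc (U' + U')) ⟩
    suc (U' + U') + y + x                ≡⟨ cong (λ z → suc (U' + U') + z + x) (sym gy) ⟩
    suc (U' + U') + arcDist n y + x      ∎)
    where open ≡-Reasoning

  FourOffsets : ℕ → ℕ → ℕ → Set
  FourOffsets u U' a = (a ≡ u) ⊎ (a ≡ suc u) ⊎ (a ≡ suc (u + u) + U') ⊎ (a ≡ suc (suc (u + u) + U'))

  differByOne-offsets-inside : ∀ {u U' a b} → u + U' ≡ M → isOdd u ≡ true → isOdd U' ≡ true → a < n →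
    b + a ≡ suc (u + u) → DifferByOne (arcDist n a) (arcDist n b) →
    FourOffsets u U' a × Σ ℕ λ w → isOdd w ≡ true × Consecutive w (arcDist n a) (arcDist n b)
  differByOne-offsets-inside {u} {U'} {a} {b} u+U′≡M odd-u odd-U′ a<n b+a≡ d₁
    with arcDist-cases a (<⇒≤ a<n) | arcDist-cases b b≤n
    where
    b≤n : b ≤ n
    b≤n = ≤-trans (m≤m+n b a) (≤-trans (≤-reflexive b+a≡)
      (≤-trans (m≤m+n (suc (u + u)) (suc (U' + U'))) (≤-reflexive (sym (n≡odd+odd u U' u+U′≡M)))))
  ... | inj₁ (ga , _) | inj₁ (gb , _) with differByOne-sum {w = u} (trans (+-comm a b) b+a≡) (subst₂ DifferByOne ga gb d₁)
  ...   | inj₁ (refl , b≡) = inj₁ refl , u , odd-u , inj₁ (ga , trans gb b≡)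
  ...   | inj₂ (refl , b≡) = inj₂ (inj₁ refl) , u , odd-u , inj₂ (ga , trans gb b≡)
  differByOne-offsets-inside {u} {U'} {a} {b} u+U′≡M odd-u odd-U′ a<n b+a≡ d₁ | inj₂ (ga , _) | inj₁ (gb , _) =
    ⊥-elim (¬DifferByOne-far (2≤1+2u {U'} odd-U′) (long-short-far {u} {U'} u+U′≡M ga gb b+a≡) d₁)
  differByOne-offsets-inside {u} {U'} {a} {b} u+U′≡M odd-u odd-U′ a<n b+a≡ d₁ | inj₁ (ga , _) | inj₂ (gb , _) =
    ⊥-elim (¬DifferByOne-far (2≤1+2u {U'} odd-U′) (long-short-far {u} {U'} u+U′≡M gb ga (trans (+-comm a b) b+a≡)) (DifferByOne-sym d₁))
  differByOne-offsets-inside {u} {U'} {a} {b} u+U′≡M odd-u odd-U′ a<n b+a≡ d₁ | inj₂ (_ , M<a) | inj₂ (_ , M<b) =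
    ⊥-elim (<-irrefl refl (begin-strict
      suc (M + M)                    <⟨ s≤s (s≤s (+-monoʳ-≤ M (≤-trans (n≤1+n M) (n≤1+n (suc M))))) ⟩
      suc (suc M) + suc (suc M)      ≤⟨ +-mono-≤ M<b M<a ⟩
      b + a                          ≡⟨ b+a≡ ⟩
      suc (u + u)                    ≤⟨ s≤s (+-mono-≤ u≤M u≤M) ⟩
      suc (M + M)                    ∎))
    where
    open ≤-Reasoning
    u≤M : u ≤ M
    u≤M = ≤-trans (m≤m+n u U') (≤-reflexive u+U′≡M)

  differByOne-offsets-beyond : ∀ {u U' a b} → u + U' ≡ M → isOdd u ≡ true → isOdd U' ≡ true → a < n →
    a ≡ suc (u + u) + b → DifferByOne (arcDist n a) (arcDist n b) →
    FourOffsets u U' a × Σ ℕ λ w → isOdd w ≡ true × Consecutive w (arcDist n a) (arcDist n b)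
  differByOne-offsets-beyond {u} {U'} {a} {b} u+U′≡M odd-u odd-U′ a<n a≡ d₁
    with arcDist-cases a (<⇒≤ a<n) | arcDist-cases b (≤-trans (≤-trans (m≤n+m b (suc (u + u))) (≤-reflexive (sym a≡))) (<⇒≤ a<n))
  ... | inj₁ (ga , _) | inj₁ (gb , _) =
    ⊥-elim (¬DifferByOne-far (2≤1+2u {u} odd-u) (trans ga (trans a≡ (cong (suc (u + u) +_) (sym gb)))) d₁)
  ... | inj₁ (_ , a≤) | inj₂ (_ , M<b) =
    ⊥-elim (<-irrefl refl (≤-trans M<b (≤-trans (≤-trans (m≤n+m b (suc (u + u))) (≤-reflexive (sym a≡))) a≤)))
  ... | inj₂ (ga , _) | inj₂ (gb , _) =
    ⊥-elim (¬DifferByOne-far (2≤1+2u {u} odd-u) gb≡ (DifferByOne-sym d₁))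
    where
    gb≡ : arcDist n b ≡ suc (u + u) + arcDist n a
    gb≡ = +-cancelʳ-≡ b _ _ (begin
      arcDist n b + b                      ≡⟨ trans gb (sym ga) ⟩
      arcDist n a + a                      ≡⟨ cong (arcDist n a +_) a≡ ⟩
      arcDist n a + (suc (u + u) + b)      ≡⟨ swap-front (arcDist n a) (suc (u + u)) b ⟩
      suc (u + u) + arcDist n a + b        ∎)
      where open ≡-Reasoning
  ... | inj₂ (ga , _) | inj₁ (gb , _) with differByOne-sum {w = U'} ga+b≡ (subst (DifferByOne (arcDist n a)) gb d₁)
    where
    ga+b≡ : arcDist n a + b ≡ suc (U' + U')
    ga+b≡ = +-cancelʳ-≡ (suc (u + u)) _ _ (begin
      arcDist n a + b + suc (u + u)        ≡⟨ swap-back (arcDist n a) b (suc (u + u)) ⟩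
      arcDist n a + (suc (u + u) + b)      ≡⟨ cong (arcDist n a +_) (sym a≡) ⟩
      arcDist n a + a                      ≡⟨ trans ga (n≡odd+odd u U' u+U′≡M) ⟩
      suc (u + u) + suc (U' + U')          ≡⟨ +-comm (suc (u + u)) _ ⟩
      suc (U' + U') + suc (u + u)          ∎)
      where open ≡-Reasoning
  ...   | inj₁ (ga≡ , refl) = inj₂ (inj₂ (inj₂ (trans a≡ (+-suc (suc (u + u)) U')))) , U' , odd-U′ , inj₁ (ga≡ , gb)
  ...   | inj₂ (ga≡ , refl) = inj₂ (inj₂ (inj₁ a≡)) , U' , odd-U′ , inj₂ (ga≡ , gb)

  -- Let lo and hi be 2u + 1 apart along one arc of C_n and 2U' + 1 along the other, u and U' odd, and
  -- let a point lie a steps after lo and b steps before or after hi. If its distances to lo and hi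
  -- differ by one, then a is one of four offsets and the two distances are w and w + 1 for an odd w.
  differByOne-offsets : ∀ {u U' a b} → u + U' ≡ M → isOdd u ≡ true → isOdd U' ≡ true → a < n →
    (b + a ≡ suc (u + u)) ⊎ (a ≡ suc (u + u) + b) → DifferByOne (arcDist n a) (arcDist n b) →
    FourOffsets u U' a × Σ ℕ λ w → isOdd w ≡ true × Consecutive w (arcDist n a) (arcDist n b)
  differByOne-offsets u+U′≡M odd-u odd-U′ a<n (inj₁ b+a≡) = differByOne-offsets-inside u+U′≡M odd-u odd-U′ a<n b+a≡
  differByOne-offsets u+U′≡M odd-u odd-U′ a<n (inj₂ a≡) = differByOne-offsets-beyond u+U′≡M odd-u odd-U′ a<n a≡

∑< : ℕ → (ℕ → ℕ) → ℕ
∑< zero f = 0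
∑< (suc L) f = ∑< L f + f L

∑<-cong : ∀ L {f g} → (∀ r → r < L → f r ≡ g r) → ∑< L f ≡ ∑< L g
∑<-cong zero h = refl
∑<-cong (suc L) h = cong₂ _+_ (∑<-cong L (λ r p → h r (m<n⇒m<1+n p))) (h L ≤-refl)

∑<-mono-≤ : ∀ L {f g} → (∀ r → r < L → f r ≤ g r) → ∑< L f ≤ ∑< L g
∑<-mono-≤ zero h = z≤n
∑<-mono-≤ (suc L) h = +-mono-≤ (∑<-mono-≤ L (λ r p → h r (m<n⇒m<1+n p))) (h L ≤-refl)

∑<-distrib-+ : ∀ L f g → ∑< L (λ r → f r + g r) ≡ ∑< L f + ∑< L g
∑<-distrib-+ zero f g = refl
∑<-distrib-+ (suc L) f g rewrite ∑<-distrib-+ L f g = interchange′ (∑< L f) (∑< L g) (f L) (g L)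
  where
  interchange′ : ∀ a b c d → a + b + (c + d) ≡ a + c + (b + d)
  interchange′ = solve-∀

∑<-const-1 : ∀ L → ∑< L (λ _ → 1) ≡ L
∑<-const-1 zero = refl
∑<-const-1 (suc L) rewrite ∑<-const-1 L = +-comm L 1

∑<-suc : ∀ L f → ∑< (suc L) f ≡ f 0 + ∑< L (λ r → f (suc r))
∑<-suc zero f = sym (+-identityʳ (f 0))
∑<-suc (suc L) f rewrite ∑<-suc L f = +-assoc (f 0) (∑< L (λ r → f (suc r))) (f (suc L))

∑<-+ : ∀ a b f → ∑< (a + b) f ≡ ∑< a f + ∑< b (λ r → f (a + r))
∑<-+ a zero f rewrite +-identityʳ a = sym (+-identityʳ _)
∑<-+ a (suc b) f rewrite +-suc a b | ∑<-+ a b f = +-assoc (∑< a f) _ (f (a + b))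

∑<-periodic-shift : ∀ L f → (∀ r → f (r + L) ≡ f r) → ∀ c → ∑< L (λ r → f (c + r)) ≡ ∑< L f
∑<-periodic-shift L f per zero = refl
∑<-periodic-shift L f per (suc c) = begin
  ∑< L (λ r → f (suc c + r))          ≡⟨ ∑<-cong L (λ r _ → cong f (sym (+-suc c r))) ⟩
  ∑< L (λ r → f (c + suc r))          ≡⟨ shift-by-one (λ r → f (c + r)) (trans (per c) (cong f (sym (+-identityʳ c)))) ⟩
  ∑< L (λ r → f (c + r))              ≡⟨ ∑<-periodic-shift L f per c ⟩
  ∑< L f                              ∎
  where
  open ≡-Reasoning
  shift-by-one : ∀ g → g L ≡ g 0 → ∑< L (λ r → g (suc r)) ≡ ∑< L g
  shift-by-one g e = +-cancelˡ-≡ (g 0) _ _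
    (trans (sym (∑<-suc L g)) (trans (cong (∑< L g +_) e) (+-comm (∑< L g) (g 0))))

∑<-fold : ∀ L f → ∑< (L + L) f ≡ ∑< L (λ s → f s + f ((L + L) ∸ suc s))
∑<-fold zero f = refl
∑<-fold (suc L) f = begin
  ∑< (suc L + suc L) f                                                            ≡⟨ cong (λ z → ∑< z f) (cong suc (+-suc L L)) ⟩
  ∑< (suc (suc (L + L))) f                                                        ≡⟨ ∑<-suc (suc (L + L)) f ⟩
  f 0 + (∑< (L + L) (λ r → f (suc r)) + f (suc (L + L)))                          ≡⟨ cong (λ z → f 0 + (z + f (suc (L + L)))) (∑<-fold L (λ r → f (suc r))) ⟩
  f 0 + (∑< L (λ s → f (suc s) + f (suc ((L + L) ∸ suc s))) + f (suc (L + L)))    ≡⟨ rearrange (f 0) _ (f (suc (L + L))) ⟩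
  (f 0 + f (suc (L + L))) + ∑< L (λ s → f (suc s) + f (suc ((L + L) ∸ suc s)))    ≡⟨ cong₂ _+_ (cong (λ z → f 0 + f z) (sym (+-suc L L))) (∑<-cong L (λ s p → cong (λ z → f (suc s) + f z) (inner s p))) ⟩
  (f 0 + f (suc L + suc L ∸ 1)) + ∑< L (λ s → f (suc s) + f (suc L + suc L ∸ suc (suc s))) ≡⟨ ∑<-suc L (λ s → f s + f ((suc L + suc L) ∸ suc s)) ⟨
  ∑< (suc L) (λ s → f s + f ((suc L + suc L) ∸ suc s))                            ∎
  where
  open ≡-Reasoning
  rearrange : ∀ a b c → a + (b + c) ≡ (a + c) + b
  rearrange = solve-∀
  inner : ∀ s → s < L → suc ((L + L) ∸ suc s) ≡ suc L + suc L ∸ suc (suc s)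
  inner s p = trans (sym (+-∸-assoc 1 (≤-trans p (m≤m+n L L)))) (cong (_∸ suc s) (sym (+-suc L L)))

∑<-odd-terms : ∀ m f → (∀ j → j < m → 1 ≤ f (suc (j + j))) → m ≤ ∑< (suc (m + m)) f
∑<-odd-terms zero f h = z≤n
∑<-odd-terms (suc m) f h = subst (suc m ≤_) (sym split)
  (≤-trans (≤-reflexive (+-comm 1 m)) (+-mono-≤ (∑<-odd-terms m f (λ j p → h j (m<n⇒m<1+n p)))
    (≤-trans (h m ≤-refl) (m≤m+n (f k) (f (suc k))))))
  where
  k = suc (m + m)
  split : ∑< (suc (suc m + suc m)) f ≡ ∑< k f + (f k + f (suc k))
  split rewrite +-suc m m = +-assoc (∑< k f) (f k) (f (suc k))

module TwoMod4Lower (N m : ℕ) (n≡4m+2 : suc N ≡ suc (suc ((m + m) + (m + m)))) where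

  open Prism N
  open TwoMod4 m n≡4m+2 using (M; even-n)
  open HalfCycle M using (FourOffsets; differByOne-offsets)

  dK-sum : ∀ {b c} e → b ≢ c → dK b e + dK c e ≡ 1
  dK-sum {F.zero} {F.zero} e b≢c = ⊥-elim (b≢c refl)
  dK-sum {F.suc F.zero} {F.suc F.zero} e b≢c = ⊥-elim (b≢c refl)
  dK-sum {F.zero} {F.suc F.zero} F.zero _ = refl
  dK-sum {F.zero} {F.suc F.zero} (F.suc F.zero) _ = refl
  dK-sum {F.suc F.zero} {F.zero} F.zero _ = refl
  dK-sum {F.suc F.zero} {F.zero} (F.suc F.zero) _ = refl

  differByOne-+ : ∀ {A B} lb lc → lb + lc ≡ 1 → A + lb ≡ B + lc → DifferByOne A B
  differByOne-+ {A} {B} zero (suc zero) _ e = inj₁ (trans (sym (+-identityʳ A)) (trans e (+-comm B 1)))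
  differByOne-+ {A} {B} (suc zero) zero _ e = inj₂ (trans (sym (+-identityʳ B)) (trans (sym e) (+-comm A 1)))

  w+0<1+w+1 : ∀ w → w + 0 < suc w + 1
  w+0<1+w+1 w = s≤s (subst (_≤ w + 1) (sym (+-identityʳ w)) (m≤m+n w 1))

  consecutive-+-even : ∀ {A B} w lb lc → isOdd w ≡ true → Consecutive w A B → lb + lc ≡ 1 → A + lb ≡ B + lc →
    isOdd (A + lb) ≡ false
  consecutive-+-even w zero (suc zero) odd-w (inj₁ (refl , refl)) _ e = ⊥-elim (<⇒≢ (w+0<1+w+1 w) e)
  consecutive-+-even w zero (suc zero) odd-w (inj₂ (refl , refl)) _ _ = trans (cong isOdd (+-identityʳ (suc w))) (cong not odd-w)
  consecutive-+-even w (suc zero) zero odd-w (inj₁ (refl , refl)) _ _ = trans (cong isOdd (+-comm w 1)) (cong not odd-w)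
  consecutive-+-even w (suc zero) zero odd-w (inj₂ (refl , refl)) _ e = ⊥-elim (<⇒≢ (w+0<1+w+1 w) (sym e))

  offset : (lo k : Fin n) → Σ ℕ λ a → (a < n) × Reduces n (toℕ lo + a) (toℕ k)
  offset lo k with toℕ lo ≤? toℕ k
  ... | yes lo≤k = toℕ k ∸ toℕ lo , ≤-<-trans (m∸n≤m (toℕ k) (toℕ lo)) (toℕ<n k) , inj₁ (sym (m+[n∸m]≡n lo≤k))
  ... | no lo≰k = (toℕ k + n) ∸ toℕ lo , lt , inj₂ (sym (m+[n∸m]≡n lo≤k+n))
    where
    lo≤k+n : toℕ lo ≤ toℕ k + n
    lo≤k+n = ≤-trans (<⇒≤ (toℕ<n lo)) (m≤n+m n (toℕ k))
    lt : (toℕ k + n) ∸ toℕ lo < n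
    lt = +-cancelʳ-< (toℕ lo) _ n (subst (_< n + toℕ lo) (sym (m∸n+n≡m lo≤k+n))
      (subst (_< n + toℕ lo) (+-comm n (toℕ k)) (+-monoʳ-< n (≰⇒> lo≰k))))

  Located : Fin n → Fin n → Fin 2 → Fin 2 → ℕ → ℕ → Set
  Located lo k b e u U' = (Σ ℕ λ a → Reduces n (toℕ lo + a) (toℕ k) × FourOffsets u U' a) × (isOdd (dP (lo , b) (k , e)) ≡ false)

  private
    located : ∀ {lo hi k : Fin n} {b c e u U' a b'} → u + U' ≡ M → isOdd u ≡ true → isOdd U' ≡ true →
      b ≢ c → dP (lo , b) (k , e) ≡ dP (hi , c) (k , e) →
      a < n → Reduces n (toℕ lo + a) (toℕ k) → (b' + a ≡ suc (u + u)) ⊎ (a ≡ suc (u + u) + b') → dC hi k ≡ arcDist n b' →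
      Located lo k b e u U'
    located {lo} {hi} {k} {b} {c} {e} {u} {U'} {a} {b'} u+U′≡M odd-u odd-U′ b≢c eqd a<n red ab dhi =
      result (differByOne-offsets u+U′≡M odd-u odd-U′ (subst (a <_) n≡4m+2 a<n) ab
               (subst₂ DifferByOne dlo≡ dhi≡ (differByOne-+ (dK b e) (dK c e) (dK-sum e b≢c) eqd)))
      where
      dlo≡ : dC lo k ≡ arcDist (suc (suc (M + M))) a
      dlo≡ = trans (cycleDist-ahead (<⇒≤ a<n) red) (cong (λ z → arcDist z a) n≡4m+2)
      dhi≡ : dC hi k ≡ arcDist (suc (suc (M + M))) b'
      dhi≡ = trans dhi (cong (λ z → arcDist z b') n≡4m+2)
      result : FourOffsets u U' a × (Σ ℕ λ w → isOdd w ≡ true × Consecutive w _ _) → Located lo k b e u U'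
      result (four , w , odd-w , consec) = (a , red , four) ,
        consecutive-+-even w (dK b e) (dK c e) odd-w (subst₂ (Consecutive w) (sym dlo≡) (sym dhi≡) consec) (dK-sum e b≢c) eqd

  -- An equalizer of two vertices on different layers whose rungs lo and hi are placed as in HalfCycle
  -- lies on one of the four rungs, at even distance from both.
  equalizer-offset : ∀ {lo hi k : Fin n} {b c e u U'} → u + U' ≡ M → isOdd u ≡ true → isOdd U' ≡ true →
    toℕ hi ≡ toℕ lo + suc (u + u) → b ≢ c → dP (lo , b) (k , e) ≡ dP (hi , c) (k , e) → Located lo k b e u U'
  equalizer-offset {lo} {hi} {k} {b} {c} {e} {u} {U'} u+U′≡M odd-u odd-U′ hi≡ b≢c eqd with offset lo k
  ... | a , a<n , red with suc (u + u) ≤? a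
  ...   | yes 2u+1≤a = located {lo} {hi} {k} {b} {c} {e} u+U′≡M odd-u odd-U′ b≢c eqd a<n red (inj₂ (sym (m+[n∸m]≡n 2u+1≤a)))
            (cycleDist-ahead (≤-trans (m∸n≤m a (suc (u + u))) (<⇒≤ a<n)) (subst (λ z → Reduces n z (toℕ k)) lo+a≡ red))
    where
    lo+a≡ : toℕ lo + a ≡ toℕ hi + (a ∸ suc (u + u))
    lo+a≡ = trans (cong (toℕ lo +_) (sym (m+[n∸m]≡n 2u+1≤a)))
      (trans (sym (+-assoc (toℕ lo) _ (a ∸ suc (u + u)))) (cong (_+ (a ∸ suc (u + u))) (sym hi≡)))
  ...   | no 2u+1≰a with red
  ...     | inj₁ k≡ = located {lo} {hi} {k} {b} {c} {e} u+U′≡M odd-u odd-U′ b≢c eqd a<n red (inj₁ (m∸n+n≡m a≤2u+1))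
            (cycleDist-behind (≤-trans (m∸n≤m (suc (u + u)) a) (gap≤n {toℕ lo} hi hi≡)) (inj₁ hi≡k+))
    where
    a≤2u+1 : a ≤ suc (u + u)
    a≤2u+1 = <⇒≤ (≰⇒> 2u+1≰a)
    hi≡k+ : toℕ hi ≡ toℕ k + (suc (u + u) ∸ a)
    hi≡k+ = trans hi≡ (trans (cong (toℕ lo +_) (sym (m+[n∸m]≡n a≤2u+1)))
      (trans (sym (+-assoc (toℕ lo) a _)) (cong (_+ (suc (u + u) ∸ a)) (sym k≡))))
  ...     | inj₂ k+n≡ = ⊥-elim (<-irrefl refl (≤-<-trans n≤hi (toℕ<n hi)))
    where
    n≤hi : n ≤ toℕ hi
    n≤hi = ≤-trans (m≤n+m n (toℕ k)) (≤-trans (≤-reflexive k+n≡)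
      (≤-trans (+-monoʳ-≤ (toℕ lo) (<⇒≤ (≰⇒> 2u+1≰a))) (≤-reflexive (sym hi≡))))

  fromℕmod : ℕ → Fin n
  fromℕmod r = fromℕ< (m%n<n r n)

  toℕ-fromℕmod : ∀ r → toℕ (fromℕmod r) ≡ r % n
  toℕ-fromℕmod r = toℕ-fromℕ< (m%n<n r n)

  fromℕmod-< : ∀ {r} → r < n → toℕ (fromℕmod r) ≡ r
  fromℕmod-< {r} r<n = trans (toℕ-fromℕmod r) (m<n⇒m%n≡m r<n)

  fromℕmod-+n : ∀ r → fromℕmod (r + n) ≡ fromℕmod r
  fromℕmod-+n r = toℕ-injective (trans (toℕ-fromℕmod (r + n)) (trans ([m+n]%n≡m%n r n) (sym (toℕ-fromℕmod r))))

  fromℕmod-Reduces : ∀ {k : Fin n} {s} → Reduces n s (toℕ k) → fromℕmod s ≡ k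
  fromℕmod-Reduces {k} {s} (inj₁ e) =
    toℕ-injective (trans (toℕ-fromℕmod s) (trans (cong (_% n) (sym e)) (m<n⇒m%n≡m (toℕ<n k))))
  fromℕmod-Reduces {k} {s} (inj₂ e) =
    toℕ-injective (trans (toℕ-fromℕmod s) (trans (cong (_% n) (sym e)) (trans ([m+n]%n≡m%n (toℕ k) n) (m<n⇒m%n≡m (toℕ<n k)))))

  module LowerBound (D : List Vertex) (isDE : IsDistanceEqualizer P D) where

    open import Data.List.Membership.DecPropositional _≟ᵛ_ using (_∈?_)

    full : Fin n → ℕ
    full k with (k , ℓ₀) ∈? D | (k , ℓ₁) ∈? D
    ... | yes _ | yes _ = 1
    ... | yes _ | no _ = 0
    ... | no _ | _ = 0

    full≡0⇒outsider : ∀ k → full k ≡ 0 → Σ (Fin 2) λ ℓ → (k , ℓ) ∉ D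
    full≡0⇒outsider k z with (k , ℓ₀) ∈? D | (k , ℓ₁) ∈? D
    ... | yes _ | no q = ℓ₁ , q
    ... | no q | _ = ℓ₀ , q

    rungInD : Fin n → List Vertex
    rungInD k with (k , ℓ₀) ∈? D | (k , ℓ₁) ∈? D
    ... | yes _ | yes _ = (k , ℓ₀) ∷ (k , ℓ₁) ∷ []
    ... | yes _ | no _ = (k , ℓ₀) ∷ []
    ... | no _ | yes _ = (k , ℓ₁) ∷ []
    ... | no _ | no _ = []

    1+full≤length-rungInD : ∀ k → suc (full k) ≤ length (rungInD k)
    1+full≤length-rungInD k with (k , ℓ₀) ∈? D | (k , ℓ₁) ∈? D | rung∩D isDE k
    ... | yes _ | yes _ | _ = ≤-refl
    ... | yes _ | no _ | _ = ≤-refl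
    ... | no _ | yes _ | _ = ≤-refl
    ... | no ∉₀ | no _ | inj₁ ∈₀ = ⊥-elim (∉₀ ∈₀)
    ... | no _ | no ∉₁ | inj₂ ∈₁ = ⊥-elim (∉₁ ∈₁)

    rungInD⊆D : ∀ k {v} → v ∈ rungInD k → v ∈ D
    rungInD⊆D k {v} v∈ with (k , ℓ₀) ∈? D | (k , ℓ₁) ∈? D
    rungInD⊆D k (here refl) | yes p | yes _ = p
    rungInD⊆D k (there (here refl)) | yes _ | yes q = q
    rungInD⊆D k (here refl) | yes p | no _ = p
    rungInD⊆D k (here refl) | no _ | yes q = q

    rungInD-fst : ∀ k {v} → v ∈ rungInD k → proj₁ v ≡ k
    rungInD-fst k {v} v∈ with (k , ℓ₀) ∈? D | (k , ℓ₁) ∈? D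
    rungInD-fst k (here refl) | yes _ | yes _ = refl
    rungInD-fst k (there (here refl)) | yes _ | yes _ = refl
    rungInD-fst k (here refl) | yes _ | no _ = refl
    rungInD-fst k (here refl) | no _ | yes _ = refl

    rungInD-unique : ∀ k → Unique (rungInD k)
    rungInD-unique k with (k , ℓ₀) ∈? D | (k , ℓ₁) ∈? D
    ... | yes _ | yes _ = ((λ ()) All.∷ All.[]) AllPairs.∷ (All.[] AllPairs.∷ AllPairs.[])
    ... | yes _ | no _ = All.[] AllPairs.∷ AllPairs.[]
    ... | no _ | yes _ = All.[] AllPairs.∷ AllPairs.[]
    ... | no _ | no _ = AllPairs.[]

    fullAt : ℕ → ℕ
    fullAt r = full (fromℕmod r)

    fullAt-periodic : ∀ r → fullAt (r + n) ≡ fullAt r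
    fullAt-periodic r = cong full (fromℕmod-+n r)

    rungsInD : ℕ → List Vertex
    rungsInD zero = []
    rungsInD (suc r) = rungInD (fromℕmod r) ++ rungsInD r

    length-rungsInD : ∀ L → length (rungsInD L) ≡ ∑< L (λ r → length (rungInD (fromℕmod r)))
    length-rungsInD zero = refl
    length-rungsInD (suc L) = trans (length-++ (rungInD (fromℕmod L)))
      (trans (cong (length (rungInD (fromℕmod L)) +_) (length-rungsInD L)) (+-comm (length (rungInD (fromℕmod L))) _))

    rungsInD⊆D : ∀ L {v} → v ∈ rungsInD L → v ∈ D
    rungsInD⊆D (suc L) {v} v∈ with ∈-++⁻ (rungInD (fromℕmod L)) v∈
    ... | inj₁ p = rungInD⊆D (fromℕmod L) p
    ... | inj₂ p = rungsInD⊆D L p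

    rungsInD-fst : ∀ L → L ≤ n → ∀ {v} → v ∈ rungsInD L → toℕ (proj₁ v) < L
    rungsInD-fst (suc L) L<n {v} v∈ with ∈-++⁻ (rungInD (fromℕmod L)) v∈
    ... | inj₁ p = ≤-reflexive (cong suc (trans (cong toℕ (rungInD-fst (fromℕmod L) p)) (fromℕmod-< L<n)))
    ... | inj₂ p = m<n⇒m<1+n (rungsInD-fst L (≤-trans (n≤1+n L) L<n) p)

    rungsInD-unique : ∀ L → L ≤ n → Unique (rungsInD L)
    rungsInD-unique zero _ = AllPairs.[]
    rungsInD-unique (suc L) L<n = ++⁺ (rungInD-unique (fromℕmod L)) (rungsInD-unique L (≤-trans (n≤1+n L) L<n)) disjoint
      where
      disjoint : ∀ {v} → ¬ ((v ∈ rungInD (fromℕmod L)) × (v ∈ rungsInD L))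
      disjoint (p , q) = <-irrefl (trans (cong toℕ (rungInD-fst (fromℕmod L) p)) (fromℕmod-< L<n))
        (rungsInD-fst L (≤-trans (n≤1+n L) L<n) q)

    n+∑full≤length : n + ∑< n fullAt ≤ length D
    n+∑full≤length = begin
      n + ∑< n fullAt                                        ≡⟨ cong (_+ ∑< n fullAt) (∑<-const-1 n) ⟨
      ∑< n (λ _ → 1) + ∑< n fullAt                           ≡⟨ ∑<-distrib-+ n (λ _ → 1) fullAt ⟨
      ∑< n (λ r → suc (fullAt r))                            ≤⟨ ∑<-mono-≤ n (λ r _ → 1+full≤length-rungInD (fromℕmod r)) ⟩
      ∑< n (λ r → length (rungInD (fromℕmod r)))             ≡⟨ length-rungsInD n ⟨
      length (rungsInD n)                                    ≤⟨ Unique⇒length≤ _≟ᵛ_ (rungsInD-unique n ≤-refl) (rungsInD⊆D n) ⟩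
      length D                                               ∎
      where open ≤-Reasoning

    outsiders-sameColour : ∀ {x y} → x ∉ D → y ∉ D → colour x ≡ colour y
    outsiders-sameColour {x} {y} x∉ y∉ with x ≟ᵛ y
    ... | yes refl = refl
    ... | no x≢y with equalize isDE x≢y x∉ y∉
    ...   | w , _ , e = ∙-cancelʳ (colour w) (colour x) (colour y)
              (trans (sym (isOdd-dP even-n x w)) (trans (cong isOdd e) (isOdd-dP even-n y w)))

    -- The outsiders on the non-full rungs lo and hi lie on different layers, so they are equalized
    -- from one of the four rungs of HalfCycle by a vertex of their own colour; if that rung is not
    -- full, its outsider has this colour as well, hence is the equalizer itself.
    someFourOffset-full : ∀ {lo hi : Fin n} {u U'} → u + U' ≡ M → isOdd u ≡ true → isOdd U' ≡ true →
      toℕ hi ≡ toℕ lo + suc (u + u) → full lo ≡ 0 → full hi ≡ 0 →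
      ¬ (∀ {k : Fin n} {a} → Reduces n (toℕ lo + a) (toℕ k) → FourOffsets u U' a → full k ≡ 0)
    someFourOffset-full {lo} {hi} {u} {U'} u+U′≡M odd-u odd-U′ hi≡ lo-nonfull hi-nonfull fourNonfull
      with full≡0⇒outsider lo lo-nonfull | full≡0⇒outsider hi hi-nonfull
    ... | b , lo∉ | c , hi∉ with b F.≟ c
    ...   | yes refl = not-¬ refl (trans (outsiders-sameColour lo∉ hi∉) colour-hi)
      where
      colour-hi : colour (hi , b) ≡ not (colour (lo , b))
      colour-hi = trans (cong (_xor bit b) (trans (cong isOdd hi≡)
          (trans (isOdd-+ (toℕ lo) (suc (u + u))) (cong (λ z → isOdd (toℕ lo) xor not z) (isOdd-double u)))))
        (trans (cong (_xor bit b) (xor-comm (isOdd (toℕ lo)) true)) (sym (not-xor (isOdd (toℕ lo)) (bit b))))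
    ...   | no b≢c with equalize isDE {lo , b} {hi , c} (λ e → b≢c (cong proj₂ e)) lo∉ hi∉
    ...     | (k , e) , w∈D , eqd with equalizer-offset {lo} {hi} {k} {b} {c} {e} u+U′≡M odd-u odd-U′ hi≡ b≢c eqd
    ...       | (a , red , four) , even-d with full≡0⇒outsider k (fourNonfull red four)
    ...         | ℓ , k∉ = k∉ (subst (λ z → (k , z) ∈ D) (sym ℓ≡e) w∈D)
      where
      colour-w : colour (k , e) ≡ colour (lo , b)
      colour-w = sym (x∙y⁻¹≈ε⇒x≈y (colour (lo , b)) (colour (k , e)) (trans (sym (isOdd-dP even-n (lo , b) (k , e))) even-d))
      ℓ≡e : ℓ ≡ e
      ℓ≡e = colour-injectiveʳ {k} (trans (outsiders-sameColour k∉ lo∉) (sym colour-w))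

    private
      L : ℕ
      L = suc M

      n≡L+L : n ≡ L + L
      n≡L+L = trans n≡4m+2 (sym (cong suc (+-suc M M)))

      odd-1+2j : ∀ j → isOdd (suc (j + j)) ≡ true
      odd-1+2j j = cong not (isOdd-double j)

      1+p+s<n : ∀ {p s} → p < L → s < M → suc p + s < n
      1+p+s<n {p} {s} p<L s<M = ≤-trans (s≤s (≤-trans (≤-reflexive (sym (+-suc p s))) (+-mono-≤ (≤-pred p<L) s<M)))
        (≤-trans (n≤1+n _) (≤-reflexive (sym n≡4m+2)))

      fromℕmod-+n′ : ∀ {s d} → s ≡ d + n → d < n → toℕ (fromℕmod s) ≡ d
      fromℕmod-+n′ {s} {d} e d<n = trans (toℕ-fromℕmod s) (trans (cong (_% n) e) (trans ([m+n]%n≡m%n d n) (m<n⇒m%n≡m d<n)))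

      full-Reduces : ∀ {k : Fin n} {s} → Reduces n s (toℕ k) → full k ≡ fullAt s
      full-Reduces red = cong full (sym (fromℕmod-Reduces red))

      module Mirror (p : ℕ) (p<L : p < L) (z₀ : fullAt p ≡ 0) (z₁ : fullAt (suc p) ≡ 0)
                    (z₂ : fullAt (p + L) ≡ 0) (z₃ : fullAt (p + suc L) ≡ 0) (j r : ℕ) (m≡ : m ≡ suc j + r) where

        s U Y : ℕ
        s = suc (j + j)
        U = suc (r + r)
        Y = (L + L) ∸ suc s

        s+U≡M : s + U ≡ M
        s+U≡M = trans (sym (ring j r)) (cong₂ _+_ (sym m≡) (sym m≡))
          where
          ring : ∀ j r → (suc j + r) + (suc j + r) ≡ suc (j + j) + suc (r + r)
          ring = solve-∀

        s<M : s < M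
        s<M = ≤-trans (≤-reflexive (+-comm 1 s)) (≤-trans (+-monoʳ-≤ s (s≤s z≤n)) (≤-reflexive s+U≡M))

        Y+1+s≡n : Y + suc s ≡ n
        Y+1+s≡n = trans (m∸n+n≡m (≤-trans (s≤s (<⇒≤ s<M)) (m≤m+n L L))) (sym n≡L+L)

        s≤p⇒⊥ : s ≤ p → fullAt (suc p + s) ≡ 0 → fullAt (suc p + Y) ≡ 0 → ⊥
        s≤p⇒⊥ s≤p za zb with ≤⇒∃+ s≤p
        ... | d , refl = someFourOffset-full {lo} {hi} {s} {U} s+U≡M (odd-1+2j j) (odd-1+2j r) hi≡ zb za fourNonfull
          where
          d<n : d < n
          d<n = ≤-<-trans (m≤n+m d s) (≤-trans p<L (≤-trans (s≤s (m≤m+n M M)) (≤-trans (n≤1+n _) (≤-reflexive (sym n≡4m+2)))))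
          lo hi : Fin n
          lo = fromℕmod (suc (s + d) + Y)
          hi = fromℕmod (suc (s + d) + s)
          toℕ-lo : toℕ lo ≡ d
          toℕ-lo = fromℕmod-+n′ (trans (ring s d Y) (cong (d +_) Y+1+s≡n)) d<n
            where
            ring : ∀ s d Y → suc (s + d) + Y ≡ d + (Y + suc s)
            ring = solve-∀
          hi≡ : toℕ hi ≡ toℕ lo + suc (s + s)
          hi≡ = trans (fromℕmod-< (1+p+s<n p<L s<M)) (trans (ring s d) (cong (_+ suc (s + s)) (sym toℕ-lo)))
            where
            ring : ∀ s d → suc (s + d) + s ≡ d + suc (s + s)
            ring = solve-∀
          fourNonfull : ∀ {k : Fin n} {a} → Reduces n (toℕ lo + a) (toℕ k) → FourOffsets s U a → full k ≡ 0
          fourNonfull {k} {a} red four = trans (full-Reduces red) (trans (cong (λ z → fullAt (z + a)) toℕ-lo) (offsets four))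
            where
            offsets : FourOffsets s U a → fullAt (d + a) ≡ 0
            offsets (inj₁ refl) = trans (cong fullAt (+-comm d s)) z₀
            offsets (inj₂ (inj₁ refl)) = trans (cong fullAt (ring s d)) z₁
              where
              ring : ∀ s d → d + suc s ≡ suc (s + d)
              ring = solve-∀
            offsets (inj₂ (inj₂ (inj₁ refl))) = trans (cong fullAt (trans (ring s d U) (cong (λ z → (s + d) + suc z) s+U≡M))) z₂
              where
              ring : ∀ s d U → d + (suc (s + s) + U) ≡ (s + d) + suc (s + U)
              ring = solve-∀
            offsets (inj₂ (inj₂ (inj₂ refl))) = trans (cong fullAt (trans (ring s d U) (cong (λ z → (s + d) + suc (suc z)) s+U≡M))) z₃
              where
              ring : ∀ s d U → d + suc (suc (s + s) + U) ≡ (s + d) + suc (suc (s + U))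
              ring = solve-∀

        s≰p⇒⊥ : ¬ s ≤ p → fullAt (suc p + s) ≡ 0 → fullAt (suc p + Y) ≡ 0 → ⊥
        s≰p⇒⊥ s≰p za zb = someFourOffset-full {lo} {hi} {U} {s} U+s≡M (odd-1+2j r) (odd-1+2j j) hi≡ za zb fourNonfull
          where
          U+s≡M : U + s ≡ M
          U+s≡M = trans (+-comm U s) s+U≡M
          Y≡ : Y ≡ s + suc (U + U)
          Y≡ = +-cancelʳ-≡ (suc s) Y (s + suc (U + U))
            (trans Y+1+s≡n (trans n≡4m+2 (trans (cong (λ z → suc (suc (z + z))) (sym U+s≡M)) (sym (ring s U)))))
            where
            ring : ∀ s U → (s + suc (U + U)) + suc s ≡ suc (suc ((U + s) + (U + s)))
            ring = solve-∀
          lo hi : Fin n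
          lo = fromℕmod (suc p + s)
          hi = fromℕmod (suc p + Y)
          toℕ-lo : toℕ lo ≡ suc p + s
          toℕ-lo = fromℕmod-< (1+p+s<n p<L s<M)
          hi≡ : toℕ hi ≡ toℕ lo + suc (U + U)
          hi≡ = trans (fromℕmod-< (subst (suc p + Y <_) (trans (+-comm (suc s) Y) Y+1+s≡n) (+-monoˡ-< Y (s≤s (≰⇒> s≰p)))))
            (trans (cong (suc p +_) Y≡) (trans (sym (+-assoc (suc p) s _)) (cong (_+ suc (U + U)) (sym toℕ-lo))))
          fourNonfull : ∀ {k : Fin n} {a} → Reduces n (toℕ lo + a) (toℕ k) → FourOffsets U s a → full k ≡ 0
          fourNonfull {k} {a} red four = trans (full-Reduces red) (trans (cong (λ z → fullAt (z + a)) toℕ-lo) (offsets four))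
            where
            offsets : FourOffsets U s a → fullAt (suc p + s + a) ≡ 0
            offsets (inj₁ refl) = trans (cong fullAt (trans (ring p s U) (cong (λ z → p + suc z) U+s≡M))) z₂
              where
              ring : ∀ p s U → suc p + s + U ≡ p + suc (U + s)
              ring = solve-∀
            offsets (inj₂ (inj₁ refl)) = trans (cong fullAt (trans (ring p s U) (cong (λ z → p + suc (suc z)) U+s≡M))) z₃
              where
              ring : ∀ p s U → suc p + s + suc U ≡ p + suc (suc (U + s))
              ring = solve-∀
            offsets (inj₂ (inj₂ (inj₁ refl))) =
              trans (cong fullAt (trans (ring p s U) (trans (cong (λ z → p + suc (suc (z + z))) U+s≡M) (cong (p +_) (sym n≡4m+2)))))
                (trans (fullAt-periodic p) z₀)
              where
              ring : ∀ p s U → suc p + s + (suc (U + U) + s) ≡ p + suc (suc ((U + s) + (U + s)))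
              ring = solve-∀
            offsets (inj₂ (inj₂ (inj₂ refl))) =
              trans (cong fullAt (trans (ring p s U) (trans (cong (λ z → suc p + suc (suc (z + z))) U+s≡M) (cong (suc p +_) (sym n≡4m+2)))))
                (trans (fullAt-periodic (suc p)) z₁)
              where
              ring : ∀ p s U → suc p + s + suc (suc (U + U) + s) ≡ suc p + suc (suc ((U + s) + (U + s)))
              ring = solve-∀

    -- If the rungs p, p + 1, p + L, p + L + 1 are not full, then for each j < m one of the rungs
    -- p + 1 + (2j + 1) and p + 1 + (2L − 2j − 2) is full: they cut C_n into arcs of lengths 2s + 1
    -- and 2U + 1 with s = 2j + 1 and U = M − s both odd, and their four offset rungs are the four above.
    mirrorPair-full : ∀ p → p < L → fullAt p ≡ 0 → fullAt (suc p) ≡ 0 → fullAt (p + L) ≡ 0 → fullAt (p + suc L) ≡ 0 →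
      ∀ j → j < m → fullAt (suc p + suc (j + j)) ≡ 0 → fullAt (suc p + ((L + L) ∸ suc (suc (j + j)))) ≡ 0 → ⊥
    mirrorPair-full p p<L z₀ z₁ z₂ z₃ j j<m with ≤⇒∃+ j<m
    ... | r , m≡ with suc (j + j) ≤? p
    ...   | yes s≤p = s≤p⇒⊥ s≤p
      where open Mirror p p<L z₀ z₁ z₂ z₃ j r m≡
    ...   | no s≰p = s≰p⇒⊥ s≰p
      where open Mirror p p<L z₀ z₁ z₂ z₃ j r m≡

    Quiet : ℕ → Set
    Quiet p = (fullAt p ≡ 0) × (fullAt (suc p) ≡ 0) × (fullAt (p + L) ≡ 0) × (fullAt (p + suc L) ≡ 0)

    quiet? : ∀ p → Dec (Quiet p)
    quiet? p = (fullAt p ≟ 0) ×-dec (fullAt (suc p) ≟ 0) ×-dec (fullAt (p + L) ≟ 0) ×-dec (fullAt (p + suc L) ≟ 0)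

    -- Folding the sum around p + 1 pairs up exactly the rungs of mirrorPair-full.
    quiet⇒m≤∑full : ∀ p → p < L → Quiet p → m ≤ ∑< n fullAt
    quiet⇒m≤∑full p p<L (z₀ , z₁ , z₂ , z₃) = subst (m ≤_) (sym ∑≡) (∑<-odd-terms m pairSum somePairFull)
      where
      shifted : ℕ → ℕ
      shifted r = fullAt (suc p + r)
      pairSum : ℕ → ℕ
      pairSum s = shifted s + shifted ((L + L) ∸ suc s)
      ∑≡ : ∑< n fullAt ≡ ∑< L pairSum
      ∑≡ = trans (sym (∑<-periodic-shift n fullAt fullAt-periodic (suc p))) (trans (cong (λ z → ∑< z shifted) n≡L+L) (∑<-fold L shifted))
      somePairFull : ∀ j → j < m → 1 ≤ pairSum (suc (j + j))
      somePairFull j j<m with shifted (suc (j + j)) ≟ 0 | shifted ((L + L) ∸ suc (suc (j + j))) ≟ 0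
      ... | no a≢0 | _ = ≤-trans (n≢0⇒n>0 a≢0) (m≤m+n _ _)
      ... | yes _ | no b≢0 = ≤-trans (n≢0⇒n>0 b≢0) (m≤n+m _ _)
      ... | yes a≡0 | yes b≡0 = ⊥-elim (mirrorPair-full p p<L z₀ z₁ z₂ z₃ j j<m a≡0 b≡0)

    -- Each rung is counted in four windows p, p + 1, p + L, p + L + 1, so 2 ∑ full ≥ L = 2m + 1.
    noisy⇒m≤∑full : (∀ p → p < L → ¬ Quiet p) → m ≤ ∑< n fullAt
    noisy⇒m≤∑full noisy = half-≤ (begin
      suc (m + m)       ≡⟨ ∑<-const-1 L ⟨
      ∑< L (λ _ → 1)    ≤⟨ ∑<-mono-≤ L (λ p p<L → n≢0⇒n>0 (λ z → noisy p p<L (window≡0⇒quiet z))) ⟩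
      ∑< L window       ≡⟨ ∑-window ⟩
      ∑< n fullAt + ∑< n fullAt ∎)
      where
      open ≤-Reasoning
      window : ℕ → ℕ
      window p = fullAt p + fullAt (suc p) + fullAt (p + L) + fullAt (p + suc L)
      window≡0⇒quiet : ∀ {p} → window p ≡ 0 → Quiet p
      window≡0⇒quiet {p} z = m+n≡0⇒m≡0 _ (m+n≡0⇒m≡0 _ (m+n≡0⇒m≡0 _ z)) , m+n≡0⇒n≡0 (fullAt p) (m+n≡0⇒m≡0 _ (m+n≡0⇒m≡0 _ z)) ,
        m+n≡0⇒n≡0 (fullAt p + fullAt (suc p)) (m+n≡0⇒m≡0 _ z) , m+n≡0⇒n≡0 (fullAt p + fullAt (suc p) + fullAt (p + L)) z
      half-≤ : ∀ {a b} → suc (a + a) ≤ b + b → a ≤ b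
      half-≤ {a} {b} le with a ≤? b
      ... | yes a≤b = a≤b
      ... | no a≰b = ⊥-elim (<-irrefl refl (≤-trans le (+-mono-≤ (<⇒≤ (≰⇒> a≰b)) (<⇒≤ (≰⇒> a≰b)))))
      A₁ A₂ A₃ A₄ : ℕ
      A₁ = ∑< L fullAt
      A₂ = ∑< L (λ r → fullAt (suc r))
      A₃ = ∑< L (λ r → fullAt (r + L))
      A₄ = ∑< L (λ r → fullAt (r + suc L))
      ∑-window : ∑< L window ≡ ∑< n fullAt + ∑< n fullAt
      ∑-window = begin-equality
        ∑< L window                ≡⟨ trans (∑<-distrib-+ L (λ p → fullAt p + fullAt (suc p) + fullAt (p + L)) (λ p → fullAt (p + suc L)))
                                        (cong (_+ A₄) (trans (∑<-distrib-+ L (λ p → fullAt p + fullAt (suc p)) (λ p → fullAt (p + L)))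
                                          (cong (_+ A₃) (∑<-distrib-+ L fullAt (λ p → fullAt (suc p)))))) ⟩
        A₁ + A₂ + A₃ + A₄          ≡⟨ interchange′ A₁ A₂ A₃ A₄ ⟩
        (A₁ + A₃) + (A₂ + A₄)      ≡⟨ cong₂ _+_ ∑≡A₁+A₃ ∑≡A₂+A₄ ⟨
        ∑< n fullAt + ∑< n fullAt  ∎
        where
        interchange′ : ∀ a b c d → a + b + c + d ≡ (a + c) + (b + d)
        interchange′ = solve-∀
        ∑≡A₁+A₃ : ∑< n fullAt ≡ A₁ + A₃
        ∑≡A₁+A₃ = trans (cong (λ z → ∑< z fullAt) n≡L+L) (trans (∑<-+ L L fullAt)
          (cong (A₁ +_) (∑<-cong L (λ r _ → cong fullAt (+-comm L r)))))
        ∑≡A₂+A₄ : ∑< n fullAt ≡ A₂ + A₄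
        ∑≡A₂+A₄ = trans (sym (∑<-periodic-shift n fullAt fullAt-periodic 1))
          (trans (cong (λ z → ∑< z (λ r → fullAt (suc r))) n≡L+L) (trans (∑<-+ L L (λ r → fullAt (suc r)))
            (cong (A₂ +_) (∑<-cong L (λ r _ → cong fullAt (trans (cong suc (+-comm L r)) (sym (+-suc r L))))))))

    m≤∑full : m ≤ ∑< n fullAt
    m≤∑full with any? {L} (λ f → quiet? (toℕ f))
    ... | yes (f , q) = quiet⇒m≤∑full (toℕ f) (toℕ<n f) q
    ... | no ¬∃ = noisy⇒m≤∑full (λ p p<L q → ¬∃ (fromℕ< p<L , subst Quiet (sym (toℕ-fromℕ< p<L)) q))

    n+m≤length : n + m ≤ length D
    n+m≤length = ≤-trans (+-monoʳ-≤ n m≤∑full) n+∑full≤length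

n≡r+4q : ∀ n {r} → n % 4 ≡ r → n ≡ r + (n / 4) * 4
n≡r+4q n r≡ = trans (m≡m%n+[m/n]*n n 4) (cong (_+ (n / 4) * 4) r≡)

4q≡2q+2q : ∀ q → q * 4 ≡ (q + q) + (q + q)
4q≡2q+2q = solve-∀

isOdd-4q : ∀ q → isOdd (q * 4) ≡ false
isOdd-4q q = trans (cong isOdd (4q≡2q+2q q)) (isOdd-double (q + q))

[5n∸2]/4≡n+q : ∀ q → (5 * (2 + q * 4) ∸ 2) / 4 ≡ (2 + q * 4) + q
[5n∸2]/4≡n+q q = begin
  (5 * (2 + q * 4) ∸ 2) / 4          ≡⟨ cong (λ z → (z ∸ 2) / 4) (ring q) ⟩
  (2 + (2 + q * 4 + q) * 4 ∸ 2) / 4  ≡⟨ cong (_/ 4) (m+n∸m≡n 2 ((2 + q * 4 + q) * 4)) ⟩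
  ((2 + q * 4 + q) * 4) / 4          ≡⟨ m*n/n≡m (2 + q * 4 + q) 4 ⟩
  2 + q * 4 + q                      ∎
  where
  open ≡-Reasoning
  ring : ∀ q → 5 * (2 + q * 4) ≡ 2 + (2 + q * 4 + q) * 4
  ring = solve-∀

module EquidistantDimensions (N : ℕ) where

  open Prism N

  ξ-odd : isOdd n ≡ true → EquidistantDimension P n
  ξ-odd odd-n = (layer₀ , layer₀-unique , layer₀-isDistanceEqualizer , length-layer₀) , λ D _ → n≤length D
    where open OddCycle odd-n

  ξ-0mod4 : ∀ q → n ≡ (q + q) + (q + q) → EquidistantDimension P n
  ξ-0mod4 q n≡4q = (black , black-unique , ZeroMod4.black-isDistanceEqualizer q n≡4q , length-black) , λ D _ → n≤length D

  ξ-2mod4 : ∀ m → n ≡ suc (suc ((m + m) + (m + m))) → EquidistantDimension P (n + m)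
  ξ-2mod4 m n≡4m+2 = (D , D-unique , D-isDistanceEqualizer , length-D) ,
    λ D′ _ isDE → TwoMod4Lower.LowerBound.n+m≤length N m n≡4m+2 D′ isDE
    where open TwoMod4 m n≡4m+2

  ξ-byResidue : ∀ r → n % 4 ≡ r → r < 4 →
    ((r ≡ 2) → EquidistantDimension P ((5 * n ∸ 2) / 4)) × (¬ (r ≡ 2) → EquidistantDimension P n)
  ξ-byResidue 0 r≡ _ = (λ ()) , λ _ → ξ-0mod4 (n / 4) (trans (n≡r+4q n r≡) (4q≡2q+2q (n / 4)))
  ξ-byResidue 1 r≡ _ = (λ ()) , λ _ → ξ-odd (trans (cong isOdd (n≡r+4q n r≡)) (cong not (isOdd-4q (n / 4))))
  ξ-byResidue 2 r≡ _ = (λ _ → subst (EquidistantDimension P) n+q≡ (ξ-2mod4 (n / 4) n≡4q+2)) , λ 2≢2 → ⊥-elim (2≢2 refl)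
    where
    n≡4q+2 : n ≡ suc (suc ((n / 4 + n / 4) + (n / 4 + n / 4)))
    n≡4q+2 = trans (n≡r+4q n r≡) (cong (2 +_) (4q≡2q+2q (n / 4)))
    n+q≡ : n + n / 4 ≡ (5 * n ∸ 2) / 4
    n+q≡ = sym (trans (cong (λ z → (5 * z ∸ 2) / 4) (n≡r+4q n r≡))
      (trans ([5n∸2]/4≡n+q (n / 4)) (cong (_+ n / 4) (sym (n≡r+4q n r≡)))))
  ξ-byResidue 3 r≡ _ = (λ ()) , λ _ → ξ-odd (trans (cong isOdd (n≡r+4q n r≡)) (cong (not ∘ not ∘ not) (isOdd-4q (n / 4))))
  ξ-byResidue (suc (suc (suc (suc _)))) _ (s≤s (s≤s (s≤s (s≤s ()))))

mainTheorem3 : ∀ (n : ℕ) → 3 ≤ n →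
    ((n % 4 ≡ 2) → EquidistantDimension (Cycle n □ K2) ((5 * n ∸ 2) / 4))
    × (¬ (n % 4 ≡ 2) → EquidistantDimension (Cycle n □ K2) n)
mainTheorem3 (suc N) _ = ξ-byResidue (suc N % 4) refl (m%n<n (suc N) 4)
  where open EquidistantDimensions N
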